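{- Let $G=(V,E)$ be a finite connected multigraph (loops and multiple edges allowed) and let $P\in\mathrm{Aut}(G)$. Then $\Theta_K(P)=\Theta_S(P)$, where $$\Theta_K(P):=\mathrm{sign}(|P_E|)\cdot \mathrm{sign}\big(\det[P_E,\,H_1(G,\mathbb{R})]\big),\qquad \Theta_S(P):=\mathrm{sign}(P_V)\cdot\prod_{e\in E}\epsilon_P(e).$$
   Context: A multigraph $G=(V,E)$ is described by half-edges: each edge $e\in E$ consists of two half-edges, and each half-edge is attached to a vertex of $V$ (a loop has both half-edges attached to the same vertex). $G$ is regarded as a 1-dimensional CW complex (vertices as 0-cells, edges as 1-cells). An automorphism $P\in\mathrm{Aut}(G)$ is a pair consisting of a permutation $P_V$ of $V$ and a permutation of the set of half-edges that maps the two half-edges of each edge to the two half-edges of a single edge and is compatible with attachment (a half-edge attached to $v$ goes to a half-edge attached to $P_V(v)$); it induces a permutation $|P_E|$ of $E$ and a cellular self-homeomorphism of $G$, hence a linear automorphism $P_E$ of the first homology group $H_1(G,\mathbb{R})$ of $G$ as a topological space with real coefficients. $\mathrm{sign}$ denotes the signature of a permutation (resp. the sign of a nonzero real number). Orient each edge arbitrarily (choose one of its half-edges as its tail); for $e\in E$, $\epsilon_P(e):=1$ if $P$ maps the tail half-edge of $e$ to the tail half-edge of $|P_E|(e)$ (i.e. $P$ respects the orientation of $e$), and $\epsilon_P(e):=-1$ otherwise (i.e. $P$ reverses it). The product $\prod_{e\in E}\epsilon_P(e)$ does not depend on the chosen orientations. -}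

module Defs where

open import Data.Nat as ℕ using (ℕ; zero; suc)
open import Data.Fin using (Fin; zero; suc; toℕ; punchIn)
open import Data.Fin.Properties using (_≟_)
open import Data.Bool using (Bool; true; false)
open import Data.Product using (_×_; _,_; proj₁; proj₂; Σ; ∃)
open import Data.Integer as ℤ using (ℤ)
open import Data.Rational as ℚ using (ℚ)
import Data.Rational.Properties as ℚP
open import Function.Bundles using (_↔_; Inverse)
open import Relation.Binary.PropositionalEquality using (_≡_)
open import Relation.Nullary using (Dec; yes; no)

sumℕ : ∀ {k} → (Fin k → ℕ) → ℕ
sumℕ {zero}  f = 0
sumℕ {suc k} f = f zero ℕ.+ sumℕ (λ i → f (suc i))

sumℚ : ∀ {k} → (Fin k → ℚ) → ℚ
sumℚ {zero}  f = ℚ.0ℚ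
sumℚ {suc k} f = f zero ℚ.+ sumℚ (λ i → f (suc i))

prodℤ : ∀ {k} → (Fin k → ℤ) → ℤ
prodℤ {zero}  f = ℤ.1ℤ
prodℤ {suc k} f = f zero ℤ.* prodℤ (λ i → f (suc i))

negOnePow : ℕ → ℤ
negOnePow zero    = ℤ.1ℤ
negOnePow (suc k) = ℤ.- negOnePow k

negOnePowℚ : ℕ → ℚ
negOnePowℚ zero    = ℚ.1ℚ
negOnePowℚ (suc k) = ℚ.- negOnePowℚ k

⌊_⌋ℕ : ∀ {a} {A : Set a} → Dec A → ℕ
⌊ yes _ ⌋ℕ = 1
⌊ no  _ ⌋ℕ = 0

inversions : ∀ {k} → (Fin k → Fin k) → ℕ
inversions f = sumℕ (λ i → sumℕ (λ j →
  ⌊ toℕ i ℕ.<? toℕ j ⌋ℕ ℕ.* ⌊ toℕ (f j) ℕ.<? toℕ (f i) ⌋ℕ))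

-- signature (as ±1 ∈ ℤ) of a map Fin k → Fin k, via the inversion count;
-- applied only to permutations
signFun : ∀ {k} → (Fin k → Fin k) → ℤ
signFun f = negOnePow (inversions f)

signPerm : ∀ {k} → (Fin k ↔ Fin k) → ℤ
signPerm π = signFun (Inverse.to π)

signℚ : ℚ → ℤ
signℚ q with q ℚP.<? ℚ.0ℚ
... | yes _ = ℤ.-1ℤ
... | no _ with q ℚP.≟ ℚ.0ℚ
...   | yes _ = ℤ.0ℤ
...   | no _  = ℤ.1ℤ

det : ∀ {k} → (Fin k → Fin k → ℚ) → ℚ
det {zero}  M = ℚ.1ℚ
det {suc k} M = sumℚ (λ j →
  negOnePowℚ (toℕ j) ℚ.* M zero j ℚ.* det (λ r c → M (suc r) (punchIn j c)))

-- Finite multigraphs via half-edges.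
-- Vertices Fin n, edges Fin m; the half-edges of edge e are (e , false)
-- (the tail, fixing an orientation) and (e , true) (the head).

record Multigraph : Set where
  field
    n m    : ℕ
    attach : Fin m × Bool → Fin n

  tail head : Fin m → Fin n
  tail e = attach (e , false)
  head e = attach (e , true)

data Reach (G : Multigraph) (u : Fin (Multigraph.n G)) : Fin (Multigraph.n G) → Set where
  here : Reach G u u
  fwd  : ∀ {v} (e : Fin (Multigraph.m G)) → Reach G u v →
         Multigraph.tail G e ≡ v → Reach G u (Multigraph.head G e)
  bwd  : ∀ {v} (e : Fin (Multigraph.m G)) → Reach G u v →
         Multigraph.head G e ≡ v → Reach G u (Multigraph.tail G e)

Connected : Multigraph → Set
Connected G = ∀ u v → Reach G u v

module _ (G : Multigraph) where
  open Multigraph G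

  record Aut : Set where
    field
      PV : Fin n ↔ Fin n
      PH : (Fin m × Bool) ↔ (Fin m × Bool)
      edgeCompat   : ∀ e → proj₁ (Inverse.to PH (e , false))
                         ≡ proj₁ (Inverse.to PH (e , true))
      attachCompat : ∀ h → attach (Inverse.to PH h) ≡ Inverse.to PV (attach h)

  module _ (P : Aut) where
    open Aut P

    PEfun : Fin m → Fin m
    PEfun e = proj₁ (Inverse.to PH (e , false))

    ε : Fin m → ℤ
    ε e with proj₂ (Inverse.to PH (e , false))
    ... | false = ℤ.1ℤ
    ... | true  = ℤ.-1ℤ

    εℚ : Fin m → ℚ
    εℚ e = ε e ℚ./ 1

    -- the chain map on 1-chains C₁(G,ℚ) = (Fin m → ℚ): e ↦ ε_P(e) · |P_E|(e)
    PE-chain : (Fin m → ℚ) → (Fin m → ℚ)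
    PE-chain z f = sumℚ (λ e → δ (PEfun e) f ℚ.* (εℚ e ℚ.* z e))
      where
      δ : Fin m → Fin m → ℚ
      δ a b with a ≟ b
      ... | yes _ = ℚ.1ℚ
      ... | no _  = ℚ.0ℚ

    ΘS : ℤ
    ΘS = signPerm PV ℤ.* prodℤ ε

  ind : Fin n → Fin n → ℚ
  ind a b with a ≟ b
  ... | yes _ = ℚ.1ℚ
  ... | no _  = ℚ.0ℚ

  boundary : (Fin m → ℚ) → (Fin n → ℚ)
  boundary z v = sumℚ (λ e → z e ℚ.* (ind (head e) v ℚ.- ind (tail e) v))

  -- H₁(G) = ker ∂ (no 2-cells)
  IsCycle : (Fin m → ℚ) → Set
  IsCycle z = ∀ v → boundary z v ≡ ℚ.0ℚ

  lincomb : ∀ {b} → (Fin b → ℚ) → (Fin b → Fin m → ℚ) → Fin m → ℚ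
  lincomb c B e = sumℚ (λ i → c i ℚ.* B i e)

  record IsCycleBasis {b : ℕ} (B : Fin b → Fin m → ℚ) : Set where
    field
      cycles : ∀ i → IsCycle (B i)
      indep  : ∀ c → (∀ e → lincomb c B e ≡ ℚ.0ℚ) → ∀ i → c i ≡ ℚ.0ℚ
      span   : ∀ z → IsCycle z → Σ (Fin b → ℚ) (λ c → ∀ e → z e ≡ lincomb c B e)

  IsMatrixOf : (P : Aut) → ∀ {b} → (Fin b → Fin m → ℚ) → (Fin b → Fin b → ℚ) → Set
  IsMatrixOf P B M = ∀ i e → PE-chain P (B i) e ≡ lincomb (M i) B e

{-# OPTIONS --safe #-}
module Submission where

-- Fix a root vertex r. As G is connected, 0 → H₁ → C₁ → C₀ → ℚ → 0 (boundary, then sum of coefficients) is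
-- exact, and a walk from r to each vertex v gives a chain path v with ∂ (path v) = v − r, which splits it:
-- Φ = [[B, 0], [path, 1]] : H₁ ⊕ C₀ → C₁ ⊕ ℚ is invertible. P acts compatibly on all four spaces: by M on H₁,
-- by the permutation matrix of σ = P_V on C₀, by A = diag ε · (permutation matrix of π = |P_E|) on C₁, and
-- trivially on ℚ. So Φ conjugates the block-triangular matrices [[M, 0], [K, σ]] and [[A, 0], [*, 1]], whence
-- det M · sign σ = det A = ∏ ε · sign π; as all these factors are ±1, sign π · sign (det M) = sign σ · ∏ ε.
-- Matrices act on row vectors, as in IsMatrixOf. The determinant is the first-row Laplace expansion of Defs;
-- its multiplicativity comes from expanding det (X ⊗ Y) by multilinearity and the fact that swapping the
-- first two rows negates it.

module LinearAlgebra where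

  open import Defs
  open import Algebra.Bundles using (CommutativeRing)
  import Algebra.Properties.Semiring.Sum as SemiringSum
  open import Data.Nat as ℕ using (ℕ; zero; suc)
  import Data.Nat.Properties as ℕP
  open import Data.Fin using (Fin; zero; suc; toℕ; punchIn; punchOut; lift; _↑ˡ_; _↑ʳ_; splitAt; join)
  open import Data.Fin.Properties
    using ( splitAt-↑ˡ; splitAt-↑ʳ; join-splitAt; punchInᵢ≢i; punchIn-punchOut; punchOut-injective
          ; punchIn-mono-≤; punchIn-cancel-≤; toℕ-↑ˡ; toℕ-injective; any?; _≟_)
  open import Data.Product using (_,_)
  open import Data.Sum using (inj₁; inj₂; [_,_]; [_,_]′)
  open import Data.Empty using (⊥-elim)
  open import Data.Integer as ℤ using (ℤ)
  open import Data.Rational as ℚ using (ℚ; 0ℚ; 1ℚ; ½; _+_; _*_; -_; _-_)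
  import Data.Rational.Properties as ℚP
  open import Algebra.Properties.Ring ℚP.+-*-ring using (-‿involutive; +-cancelˡ)
  open import Data.Rational.Solver using (module +-*-Solver)
  open import Data.Vec.Functional using ([]; _∷_)
  open import Function using (_∘_)
  open import Function.Definitions using (Injective)
  open import Relation.Binary.Definitions using (tri<; tri≈; tri>)
  open import Relation.Binary.PropositionalEquality
  open import Relation.Nullary using (Dec; yes; no; ¬_)

  open +-*-Solver

  private
    module ∑ = SemiringSum (CommutativeRing.semiring ℚP.+-*-commutativeRing)

  sumℚ≡sum : ∀ {k} (f : Fin k → ℚ) → sumℚ f ≡ ∑.sum f
  sumℚ≡sum {zero}  f = refl
  sumℚ≡sum {suc k} f = cong (f zero +_) (sumℚ≡sum (f ∘ suc))

  sum-cong : ∀ {k} {f g : Fin k → ℚ} → (∀ i → f i ≡ g i) → sumℚ f ≡ sumℚ g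
  sum-cong {zero}  f≗g = refl
  sum-cong {suc k} f≗g = cong₂ _+_ (f≗g zero) (sum-cong (f≗g ∘ suc))

  sum-zero : ∀ {k} (f : Fin k → ℚ) → (∀ i → f i ≡ 0ℚ) → sumℚ f ≡ 0ℚ
  sum-zero {zero}  f f≗0 = refl
  sum-zero {suc k} f f≗0 = cong₂ _+_ (f≗0 zero) (sum-zero (f ∘ suc) (f≗0 ∘ suc))

  sum-distrib-+ : ∀ {k} (f g : Fin k → ℚ) → sumℚ (λ i → f i + g i) ≡ sumℚ f + sumℚ g
  sum-distrib-+ f g = begin
    sumℚ (λ i → f i + g i)   ≡⟨ sumℚ≡sum (λ i → f i + g i) ⟩
    ∑.sum (λ i → f i + g i)  ≡⟨ ∑.∑-distrib-+ f g ⟩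
    ∑.sum f + ∑.sum g        ≡⟨ cong₂ _+_ (sumℚ≡sum f) (sumℚ≡sum g) ⟨
    sumℚ f + sumℚ g          ∎
    where open ≡-Reasoning

  *-distribˡ-sum : ∀ {k} (x : ℚ) (f : Fin k → ℚ) → x * sumℚ f ≡ sumℚ (λ i → x * f i)
  *-distribˡ-sum x f = begin
    x * sumℚ f                ≡⟨ cong (x *_) (sumℚ≡sum f) ⟩
    x * ∑.sum f               ≡⟨ ∑.*-distribˡ-sum x f ⟩
    ∑.sum (λ i → x * f i)     ≡⟨ sumℚ≡sum (λ i → x * f i) ⟨
    sumℚ (λ i → x * f i)      ∎
    where open ≡-Reasoning

  *-distribʳ-sum : ∀ {k} (x : ℚ) (f : Fin k → ℚ) → sumℚ f * x ≡ sumℚ (λ i → f i * x)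
  *-distribʳ-sum x f = begin
    sumℚ f * x                ≡⟨ cong (_* x) (sumℚ≡sum f) ⟩
    ∑.sum f * x               ≡⟨ ∑.*-distribʳ-sum x f ⟩
    ∑.sum (λ i → f i * x)     ≡⟨ sumℚ≡sum (λ i → f i * x) ⟨
    sumℚ (λ i → f i * x)      ∎
    where open ≡-Reasoning

  neg-distrib-sum : ∀ {k} (f : Fin k → ℚ) → - sumℚ f ≡ sumℚ (λ i → - f i)
  neg-distrib-sum {zero}  f = refl
  neg-distrib-sum {suc k} f =
    trans (ℚP.neg-distrib-+ (f zero) _) (cong (- f zero +_) (neg-distrib-sum (f ∘ suc)))

  sum-distrib-− : ∀ {k} (f g : Fin k → ℚ) → sumℚ (λ i → f i - g i) ≡ sumℚ f - sumℚ g
  sum-distrib-− f g =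
    trans (sum-distrib-+ f (λ i → - g i)) (cong (sumℚ f +_) (sym (neg-distrib-sum g)))

  sum-comm : ∀ {k l} (f : Fin k → Fin l → ℚ) →
             sumℚ (λ i → sumℚ (f i)) ≡ sumℚ (λ j → sumℚ (λ i → f i j))
  sum-comm f = begin
    sumℚ (λ i → sumℚ (f i))              ≡⟨ nested (λ i j → f i j) ⟩
    ∑.sum (λ i → ∑.sum (f i))            ≡⟨ ∑.∑-comm f ⟩
    ∑.sum (λ j → ∑.sum (λ i → f i j))    ≡⟨ nested (λ j i → f i j) ⟨
    sumℚ (λ j → sumℚ (λ i → f i j))      ∎
    where
    open ≡-Reasoning
    nested : ∀ {p q} (g : Fin p → Fin q → ℚ) → sumℚ (λ i → sumℚ (g i)) ≡ ∑.sum (λ i → ∑.sum (g i))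
    nested g = trans (sumℚ≡sum (λ i → sumℚ (g i))) (∑.sum-cong-≗ (sumℚ≡sum ∘ g))

  sum-punchIn : ∀ {k} (a : Fin (suc k)) (f : Fin (suc k) → ℚ) →
                sumℚ f ≡ f a + sumℚ (f ∘ punchIn a)
  sum-punchIn a f = begin
    sumℚ f                         ≡⟨ sumℚ≡sum f ⟩
    ∑.sum f                        ≡⟨ ∑.sum-remove f ⟩
    f a + ∑.sum (f ∘ punchIn a)    ≡⟨ cong (f a +_) (sumℚ≡sum (f ∘ punchIn a)) ⟨
    f a + sumℚ (f ∘ punchIn a)     ∎
    where open ≡-Reasoning

  sum-↑ : ∀ {a c} (f : Fin (a ℕ.+ c) → ℚ) →
          sumℚ f ≡ sumℚ (λ i → f (i ↑ˡ c)) + sumℚ (λ j → f (a ↑ʳ j))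
  sum-↑ {zero}      f = sym (ℚP.+-identityˡ (sumℚ f))
  sum-↑ {suc a} {c} f =
    trans (cong (f zero +_) (sum-↑ {a} (f ∘ suc))) (sym (ℚP.+-assoc (f zero) _ _))

  δ : ∀ {k} → Fin k → Fin k → ℚ
  δ zero    zero    = 1ℚ
  δ zero    (suc _) = 0ℚ
  δ (suc _) zero    = 0ℚ
  δ (suc i) (suc j) = δ i j

  δ-refl : ∀ {k} (a : Fin k) → δ a a ≡ 1ℚ
  δ-refl zero    = refl
  δ-refl (suc a) = δ-refl a

  δ-sym : ∀ {k} (a b : Fin k) → δ a b ≡ δ b a
  δ-sym zero    zero    = refl
  δ-sym zero    (suc b) = refl
  δ-sym (suc a) zero    = refl
  δ-sym (suc a) (suc b) = δ-sym a b

  δ-≢ : ∀ {k} {a b : Fin k} → a ≢ b → δ a b ≡ 0ℚ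
  δ-≢ {a = zero}  {zero}  a≢b = ⊥-elim (a≢b refl)
  δ-≢ {a = zero}  {suc b} a≢b = refl
  δ-≢ {a = suc a} {zero}  a≢b = refl
  δ-≢ {a = suc a} {suc b} a≢b = δ-≢ (a≢b ∘ cong suc)

  δ-punchIn : ∀ {k} (a : Fin (suc k)) (c : Fin k) → δ a (punchIn a c) ≡ 0ℚ
  δ-punchIn a c = δ-≢ (punchInᵢ≢i a c ∘ sym)

  δ-punchIn-punchIn : ∀ {k} (a : Fin (suc k)) (x c : Fin k) → δ (punchIn a x) (punchIn a c) ≡ δ x c
  δ-punchIn-punchIn zero    x       c       = refl
  δ-punchIn-punchIn (suc a) zero    zero    = refl
  δ-punchIn-punchIn (suc a) zero    (suc c) = refl
  δ-punchIn-punchIn (suc a) (suc x) zero    = refl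
  δ-punchIn-punchIn (suc a) (suc x) (suc c) = δ-punchIn-punchIn a x c

  *-zero-middle : ∀ (a : ℚ) {x} (b : ℚ) → x ≡ 0ℚ → a * x * b ≡ 0ℚ
  *-zero-middle a b refl = trans (cong (_* b) (ℚP.*-zeroʳ a)) (ℚP.*-zeroˡ b)

  sum-δˡ : ∀ {k} (a : Fin k) (g : Fin k → ℚ) → sumℚ (λ j → δ a j * g j) ≡ g a
  sum-δˡ {suc k} a g = begin
    sumℚ (λ j → δ a j * g j)                                  ≡⟨ sum-punchIn a (λ j → δ a j * g j) ⟩
    δ a a * g a + sumℚ (λ c → δ a (punchIn a c) * g (punchIn a c))
      ≡⟨ cong₂ _+_ (cong (_* g a) (δ-refl a))
                   (sum-zero (λ c → δ a (punchIn a c) * g (punchIn a c)) λ c →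
                      trans (cong (_* g (punchIn a c)) (δ-punchIn a c)) (ℚP.*-zeroˡ (g (punchIn a c)))) ⟩
    1ℚ * g a + 0ℚ
      ≡⟨ solve 1 (λ x → con 1ℚ :* x :+ con 0ℚ := x) refl (g a) ⟩
    g a
      ∎
    where open ≡-Reasoning

  sum-δʳ : ∀ {k} (a : Fin k) (g : Fin k → ℚ) → sumℚ (λ j → g j * δ j a) ≡ g a
  sum-δʳ a g = trans (sum-cong λ j → trans (ℚP.*-comm (g j) _) (cong (_* g j) (δ-sym j a))) (sum-δˡ a g)

  sum-δ : ∀ {k} (a : Fin k) → sumℚ (δ a) ≡ 1ℚ
  sum-δ a = trans (sum-cong λ v → sym (ℚP.*-identityʳ (δ a v))) (sum-δˡ a (λ _ → 1ℚ))

  Mat : ℕ → ℕ → Set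
  Mat p q = Fin p → Fin q → ℚ

  infixl 7 _·_ _⊗_

  _·_ : ∀ {p q} → (Fin p → ℚ) → Mat p q → Fin q → ℚ
  (z · X) j = sumℚ (λ i → z i * X i j)

  _⊗_ : ∀ {p q r} → Mat p q → Mat q r → Mat p r
  (X ⊗ Y) i = X i · Y

  ·-assoc : ∀ {p q r} (z : Fin p → ℚ) (X : Mat p q) (Y : Mat q r) k → (z · X · Y) k ≡ (z · (X ⊗ Y)) k
  ·-assoc z X Y k = begin
    sumℚ (λ j → sumℚ (λ i → z i * X i j) * Y j k)
      ≡⟨ sum-cong (λ j → *-distribʳ-sum (Y j k) (λ i → z i * X i j)) ⟩
    sumℚ (λ j → sumℚ (λ i → z i * X i j * Y j k))
      ≡⟨ sum-comm (λ j i → z i * X i j * Y j k) ⟩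
    sumℚ (λ i → sumℚ (λ j → z i * X i j * Y j k))
      ≡⟨ sum-cong (λ i → sum-cong λ j → ℚP.*-assoc (z i) (X i j) (Y j k)) ⟩
    sumℚ (λ i → sumℚ (λ j → z i * (X i j * Y j k)))
      ≡⟨ sum-cong (λ i → *-distribˡ-sum (z i) (λ j → X i j * Y j k)) ⟨
    sumℚ (λ i → z i * sumℚ (λ j → X i j * Y j k))
      ∎
    where open ≡-Reasoning

  ·-congˡ : ∀ {p q} {z w : Fin p → ℚ} (X : Mat p q) → (∀ i → z i ≡ w i) → ∀ j → (z · X) j ≡ (w · X) j
  ·-congˡ X z≗w j = sum-cong λ i → cong (_* X i j) (z≗w i)

  ·-congʳ : ∀ {p q} (z : Fin p → ℚ) (X Y : Mat p q) j → (∀ i → X i j ≡ Y i j) → (z · X) j ≡ (z · Y) j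
  ·-congʳ z X Y j X≗Y = sum-cong λ i → cong (z i *_) (X≗Y i)

  δ-· : ∀ {p q} (a : Fin p) (X : Mat p q) j → (δ a · X) j ≡ X a j
  δ-· a X j = sum-δˡ a (λ i → X i j)

  ·-δ : ∀ {p} (z : Fin p → ℚ) j → (z · δ) j ≡ z j
  ·-δ z j = sum-δʳ j z

  ·-distribʳ-+ : ∀ {p q} (z w : Fin p → ℚ) (X : Mat p q) j → ((λ i → z i + w i) · X) j ≡ (z · X) j + (w · X) j
  ·-distribʳ-+ z w X j =
    trans (sum-cong λ i → ℚP.*-distribʳ-+ (X i j) (z i) (w i)) (sum-distrib-+ (λ i → z i * X i j) (λ i → w i * X i j))

  ·-distribʳ-− : ∀ {p q} (z w : Fin p → ℚ) (X : Mat p q) j → ((λ i → z i - w i) · X) j ≡ (z · X) j - (w · X) j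
  ·-distribʳ-− z w X j = begin
    ((λ i → z i - w i) · X) j      ≡⟨ ·-distribʳ-+ z (λ i → - w i) X j ⟩
    (z · X) j + sumℚ (λ i → - w i * X i j)
      ≡⟨ cong ((z · X) j +_) (sum-cong λ i → sym (ℚP.neg-distribˡ-* (w i) (X i j))) ⟩
    (z · X) j + sumℚ (λ i → - (w i * X i j))
      ≡⟨ cong ((z · X) j +_) (neg-distrib-sum (λ i → w i * X i j)) ⟨
    (z · X) j - (w · X) j          ∎
    where open ≡-Reasoning

  ·-distribˡ-− : ∀ {p q} (z : Fin p → ℚ) (X Y : Mat p q) j →
                 (z · (λ i l → X i l - Y i l)) j ≡ (z · X) j - (z · Y) j
  ·-distribˡ-− z X Y j = begin
    sumℚ (λ i → z i * (X i j - Y i j))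
      ≡⟨ sum-cong (λ i → solve 3 (λ a x y → a :* (x :- y) := a :* x :- a :* y) refl (z i) (X i j) (Y i j)) ⟩
    sumℚ (λ i → z i * X i j - z i * Y i j)
      ≡⟨ sum-distrib-− (λ i → z i * X i j) (λ i → z i * Y i j) ⟩
    (z · X) j - (z · Y) j
      ∎
    where open ≡-Reasoning

  ·-zeroˡ : ∀ {p q} {z : Fin p → ℚ} (X : Mat p q) → (∀ i → z i ≡ 0ℚ) → ∀ j → (z · X) j ≡ 0ℚ
  ·-zeroˡ {z = z} X z≗0 j = sum-zero (λ i → z i * X i j) λ i → trans (cong (_* X i j) (z≗0 i)) (ℚP.*-zeroˡ (X i j))

  ·-zeroʳ : ∀ {p q} (z : Fin p → ℚ) {X : Mat p q} j → (∀ i → X i j ≡ 0ℚ) → (z · X) j ≡ 0ℚ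
  ·-zeroʳ z {X} j X≗0 = sum-zero (λ i → z i * X i j) λ i → trans (cong (z i *_) (X≗0 i)) (ℚP.*-zeroʳ (z i))

  infix 8 -1^_

  -1^_ : ℕ → ℚ
  -1^_ = negOnePowℚ

  -1^-+ : ∀ a b → -1^ (a ℕ.+ b) ≡ -1^ a * -1^ b
  -1^-+ zero    b = sym (ℚP.*-identityˡ (-1^ b))
  -1^-+ (suc a) b = trans (cong -_ (-1^-+ a b)) (ℚP.neg-distribˡ-* (-1^ a) (-1^ b))

  -1^-square : ∀ n → -1^ n * -1^ n ≡ 1ℚ
  -1^-square zero    = refl
  -1^-square (suc n) =
    trans (solve 1 (λ x → (:- x) :* (:- x) := x :* x) refl (-1^ n)) (-1^-square n)

  minor : ∀ {k} → Mat (suc k) (suc k) → Fin (suc k) → Fin (suc k) → Mat k k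
  minor M i j r c = M (punchIn i r) (punchIn j c)

  det-cong : ∀ {k} {M N : Mat k k} → (∀ i j → M i j ≡ N i j) → det M ≡ det N
  det-cong {zero}  M≗N = refl
  det-cong {suc k} M≗N = sum-cong λ j →
    cong₂ (λ x y → -1^ toℕ j * x * y) (M≗N zero j) (det-cong λ r c → M≗N (suc r) (punchIn j c))

  det-sparseFirstRow : ∀ {k} (M : Mat (suc k) (suc k)) → (∀ j → M zero (suc j) ≡ 0ℚ) →
                       det M ≡ M zero zero * det (minor M zero zero)
  det-sparseFirstRow M row₀≡0 = begin
    det M
      ≡⟨ cong (1ℚ * M zero zero * det (minor M zero zero) +_)
              (sum-zero (λ j → -1^ toℕ (suc j) * M zero (suc j) * det (minor M zero (suc j)))
                        (λ j → *-zero-middle (-1^ toℕ (suc j)) (det (minor M zero (suc j))) (row₀≡0 j))) ⟩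
    1ℚ * M zero zero * det (minor M zero zero) + 0ℚ
      ≡⟨ solve 2 (λ x d → con 1ℚ :* x :* d :+ con 0ℚ := x :* d) refl (M zero zero) (det (minor M zero zero)) ⟩
    M zero zero * det (minor M zero zero)
      ∎
    where open ≡-Reasoning

  det-identity : ∀ {k} → det {k} δ ≡ 1ℚ
  det-identity {zero}  = refl
  det-identity {suc k} =
    trans (det-sparseFirstRow {k} δ (λ _ → refl)) (trans (ℚP.*-identityˡ (det {k} δ)) (det-identity {k}))

  prodℚ : ∀ {k} → (Fin k → ℚ) → ℚ
  prodℚ {zero}  f = 1ℚ
  prodℚ {suc k} f = f zero * prodℚ (f ∘ suc)

  det-diagonal : ∀ {k} (d : Fin k → ℚ) → det (λ i j → d i * δ i j) ≡ prodℚ d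
  det-diagonal {zero}  d = refl
  det-diagonal {suc k} d =
    trans (det-sparseFirstRow (λ i j → d i * δ i j) (λ _ → ℚP.*-zeroʳ (d zero)))
          (cong₂ _*_ (ℚP.*-identityʳ (d zero)) (det-diagonal (d ∘ suc)))

  punchIn-↑ˡ : ∀ {a} c (j : Fin (suc a)) (x : Fin a) → punchIn (j ↑ˡ c) (x ↑ˡ c) ≡ punchIn j x ↑ˡ c
  punchIn-↑ˡ c zero    x       = refl
  punchIn-↑ˡ c (suc j) zero    = refl
  punchIn-↑ˡ c (suc j) (suc x) = cong suc (punchIn-↑ˡ c j x)

  punchIn-↑ʳ : ∀ a {c} (j : Fin (suc a)) (t : Fin c) → punchIn (j ↑ˡ c) (a ↑ʳ t) ≡ suc a ↑ʳ t
  punchIn-↑ʳ a       zero    t = refl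
  punchIn-↑ʳ (suc a) (suc j) t = cong suc (punchIn-↑ʳ a j t)

  det-blockTriangular : ∀ {a c} (M : Mat (a ℕ.+ c) (a ℕ.+ c)) → (∀ i j → M (i ↑ˡ c) (a ↑ʳ j) ≡ 0ℚ) →
    det M ≡ det (λ i j → M (i ↑ˡ c) (j ↑ˡ c)) * det (λ i j → M (a ↑ʳ i) (a ↑ʳ j))
  det-blockTriangular {zero}      M _        = sym (ℚP.*-identityˡ (det M))
  det-blockTriangular {suc a} {c} M upper≡0 = begin
    det M
      ≡⟨ sum-↑ {suc a} term ⟩
    sumℚ (λ j → term (j ↑ˡ c)) + sumℚ (λ t → term (suc a ↑ʳ t))
      ≡⟨ cong (sumℚ (λ j → term (j ↑ˡ c)) +_)
              (sum-zero (λ t → term (suc a ↑ʳ t))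
                        λ t → *-zero-middle (-1^ toℕ (suc a ↑ʳ t)) (det (minor M zero (suc a ↑ʳ t))) (upper≡0 zero t)) ⟩
    sumℚ (λ j → term (j ↑ˡ c)) + 0ℚ
      ≡⟨ ℚP.+-identityʳ (sumℚ (λ j → term (j ↑ˡ c))) ⟩
    sumℚ (λ j → term (j ↑ˡ c))
      ≡⟨ sum-cong split ⟩
    sumℚ (λ j → -1^ toℕ j * UL zero j * det (minor UL zero j) * det LR)
      ≡⟨ *-distribʳ-sum (det LR) (λ j → -1^ toℕ j * UL zero j * det (minor UL zero j)) ⟨
    det UL * det LR
      ∎
    where
    open ≡-Reasoning
    UL : Mat (suc a) (suc a)
    UL i j = M (i ↑ˡ c) (j ↑ˡ c)
    LR : Mat c c
    LR i j = M (suc a ↑ʳ i) (suc a ↑ʳ j)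
    term : Fin (suc a ℕ.+ c) → ℚ
    term j = -1^ toℕ j * M zero j * det (minor M zero j)
    split : ∀ j → term (j ↑ˡ c) ≡ -1^ toℕ j * UL zero j * det (minor UL zero j) * det LR
    split j = begin
      -1^ toℕ (j ↑ˡ c) * UL zero j * det Mj
        ≡⟨ cong₂ (λ x y → -1^ x * UL zero j * y) (toℕ-↑ˡ j c)
                 (det-blockTriangular Mj λ i t → trans (cong (M (suc (i ↑ˡ c))) (punchIn-↑ʳ a j t)) (upper≡0 (suc i) t)) ⟩
      -1^ toℕ j * UL zero j * (det (λ r l → Mj (r ↑ˡ c) (l ↑ˡ c)) * det (λ r l → Mj (a ↑ʳ r) (a ↑ʳ l)))
        ≡⟨ cong₂ (λ x y → -1^ toℕ j * UL zero j * (x * y))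
                 (det-cong λ r l → cong (M (suc (r ↑ˡ c))) (punchIn-↑ˡ c j l))
                 (det-cong λ r l → cong (M (suc (a ↑ʳ r))) (punchIn-↑ʳ a j l)) ⟩
      -1^ toℕ j * UL zero j * (det (minor UL zero j) * det LR)
        ≡⟨ ℚP.*-assoc (-1^ toℕ j * UL zero j) (det (minor UL zero j)) (det LR) ⟨
      -1^ toℕ j * UL zero j * det (minor UL zero j) * det LR
        ∎
      where
      Mj : Mat (a ℕ.+ c) (a ℕ.+ c)
      Mj = minor M zero (j ↑ˡ c)

  -- punchOut without the proof of i ≢ j: a junk value when i ≡ j.
  punchOut′ : ∀ {k} → Fin (suc (suc k)) → Fin (suc (suc k)) → Fin (suc k)
  punchOut′           zero    zero    = zero
  punchOut′           zero    (suc j) = j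
  punchOut′           (suc i) zero    = zero
  punchOut′ {zero}    (suc i) (suc j) = zero
  punchOut′ {suc k}   (suc i) (suc j) = suc (punchOut′ i j)

  punchOut′-punchIn : ∀ {k} (i : Fin (suc (suc k))) (l : Fin (suc k)) → punchOut′ i (punchIn i l) ≡ l
  punchOut′-punchIn         zero    l       = refl
  punchOut′-punchIn         (suc i) zero    = refl
  punchOut′-punchIn {suc k} (suc i) (suc l) = cong suc (punchOut′-punchIn i l)

  without : ∀ {k} → Fin (suc (suc k)) → Fin (suc (suc k)) → Fin k → Fin (suc (suc k))
  without i j c = punchIn i (punchIn (punchOut′ i j) c)

  without-sym : ∀ {k} {i j : Fin (suc (suc k))} → i ≢ j → ∀ c → without i j c ≡ without j i c
  without-sym         {i = zero}  {zero}  i≢j c       = ⊥-elim (i≢j refl)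
  without-sym         {i = zero}  {suc j} i≢j c       = refl
  without-sym         {i = suc i} {zero}  i≢j c       = refl
  without-sym {zero}  {i = suc zero} {suc zero} i≢j c = ⊥-elim (i≢j refl)
  without-sym {suc k} {i = suc i} {suc j} i≢j zero    = refl
  without-sym {suc k} {i = suc i} {suc j} i≢j (suc c) = cong suc (without-sym (i≢j ∘ cong suc) c)

  punchOut′-parity : ∀ {k} {i j : Fin (suc (suc k))} → toℕ i ℕ.< toℕ j →
                     suc (toℕ i ℕ.+ toℕ (punchOut′ i j)) ≡ toℕ j ℕ.+ toℕ (punchOut′ j i)
  punchOut′-parity         {i = zero}  {suc j} i<j = cong suc (sym (ℕP.+-identityʳ (toℕ j)))
  punchOut′-parity {zero}  {i = suc zero} {suc zero} (ℕ.s≤s ())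
  punchOut′-parity {suc k} {i = suc i} {suc j} (ℕ.s≤s i<j) = cong suc (begin
    suc (toℕ i ℕ.+ suc (toℕ (punchOut′ i j)))  ≡⟨ cong suc (ℕP.+-suc (toℕ i) _) ⟩
    suc (suc (toℕ i ℕ.+ toℕ (punchOut′ i j)))  ≡⟨ cong suc (punchOut′-parity i<j) ⟩
    suc (toℕ j ℕ.+ toℕ (punchOut′ j i))        ≡⟨ ℕP.+-suc (toℕ j) _ ⟨
    toℕ j ℕ.+ suc (toℕ (punchOut′ j i))        ∎)
    where open ≡-Reasoning

  pairSign : ∀ {k} → Fin (suc (suc k)) → Fin (suc (suc k)) → ℚ
  pairSign i j = -1^ (toℕ i ℕ.+ toℕ (punchOut′ i j))

  pairSign-antisym : ∀ {k} {i j : Fin (suc (suc k))} → i ≢ j → pairSign j i ≡ - pairSign i j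
  pairSign-antisym {i = i} {j} i≢j with ℕP.<-cmp (toℕ i) (toℕ j)
  ... | tri< i<j _ _ = cong -1^_ (sym (punchOut′-parity i<j))
  ... | tri≈ _ i≡j _ = ⊥-elim (i≢j (toℕ-injective i≡j))
  ... | tri> _ _ j<i = trans (sym (-‿involutive _)) (cong (-_ ∘ -1^_) (punchOut′-parity j<i))

  pairTerm : ∀ {k} → Mat (suc (suc k)) (suc (suc k)) → Fin (suc (suc k)) → Fin (suc (suc k)) → ℚ
  pairTerm Y i j = (1ℚ - δ i j) * (pairSign i j * Y zero i * Y (suc zero) j * det (λ r c → Y (suc (suc r)) (without i j c)))

  pairTerm-diagonal : ∀ {k} (Y : Mat (suc (suc k)) (suc (suc k))) i → pairTerm Y i i ≡ 0ℚ
  pairTerm-diagonal Y i =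
    trans (cong (λ d → (1ℚ - d) * x) (δ-refl i)) (solve 1 (λ x → (con 1ℚ :- con 1ℚ) :* x := con 0ℚ) refl x)
    where
    x : ℚ
    x = pairSign i i * Y zero i * Y (suc zero) i * det (λ r c → Y (suc (suc r)) (without i i c))

  -- Expansion along the first two rows; the factor 1 − δ i j lets the sum run over all pairs of columns.
  det-pairExpansion : ∀ {k} (Y : Mat (suc (suc k)) (suc (suc k))) → det Y ≡ sumℚ (λ i → sumℚ (pairTerm Y i))
  det-pairExpansion Y = sum-cong row
    where
    row : ∀ i → -1^ toℕ i * Y zero i * det (minor Y zero i) ≡ sumℚ (pairTerm Y i)
    row i = sym (begin
      sumℚ (pairTerm Y i)
        ≡⟨ sum-punchIn i (pairTerm Y i) ⟩
      pairTerm Y i i + sumℚ (pairTerm Y i ∘ punchIn i)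
        ≡⟨ cong₂ _+_ (pairTerm-diagonal Y i) (sum-cong offDiagonal) ⟩
      0ℚ + sumℚ (λ l → -1^ toℕ i * Y zero i * laplaceTerm l)
        ≡⟨ ℚP.+-identityˡ (sumℚ (λ l → -1^ toℕ i * Y zero i * laplaceTerm l)) ⟩
      sumℚ (λ l → -1^ toℕ i * Y zero i * laplaceTerm l)
        ≡⟨ *-distribˡ-sum (-1^ toℕ i * Y zero i) laplaceTerm ⟨
      -1^ toℕ i * Y zero i * det (minor Y zero i)
        ∎)
      where
      open ≡-Reasoning
      laplaceTerm : Fin _ → ℚ
      laplaceTerm l = -1^ toℕ l * minor Y zero i zero l * det (minor (minor Y zero i) zero l)
      offDiagonal : ∀ l → pairTerm Y i (punchIn i l) ≡ -1^ toℕ i * Y zero i * laplaceTerm l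
      offDiagonal l rewrite δ-punchIn i l | punchOut′-punchIn i l | -1^-+ (toℕ i) (toℕ l) =
        solve 5 (λ a b x y d → (con 1ℚ :- con 0ℚ) :* (a :* b :* x :* y :* d) := a :* x :* (b :* y :* d)) refl
          (-1^ toℕ i) (-1^ toℕ l) (Y zero i) (Y (suc zero) (punchIn i l)) (det (minor (minor Y zero i) zero l))

  swap₀₁ : ∀ {k} → Fin (suc (suc k)) → Fin (suc (suc k))
  swap₀₁ zero          = suc zero
  swap₀₁ (suc zero)    = zero
  swap₀₁ (suc (suc r)) = suc (suc r)

  pairTerm-swap₀₁ : ∀ {k} (Y : Mat (suc (suc k)) (suc (suc k))) i j → pairTerm (Y ∘ swap₀₁) i j ≡ - pairTerm Y j i
  pairTerm-swap₀₁ Y i j with i ≟ j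
  ... | yes refl = trans (pairTerm-diagonal (Y ∘ swap₀₁) i) (sym (cong -_ (pairTerm-diagonal Y i)))
  ... | no i≢j   = begin
    (1ℚ - δ i j) * (pairSign i j * Y (suc zero) i * Y zero j * det (λ r c → Y (suc (suc r)) (without i j c)))
      ≡⟨ cong₂ (λ d D → (1ℚ - d) * (pairSign i j * Y (suc zero) i * Y zero j * D)) (δ-sym i j)
               (det-cong λ r c → cong (Y (suc (suc r))) (without-sym i≢j c)) ⟩
    (1ℚ - δ j i) * (pairSign i j * Y (suc zero) i * Y zero j * D)
      ≡⟨ solve 5 (λ d s y₁ y₀ x → (con 1ℚ :- d) :* (s :* y₁ :* y₀ :* x)
                                 := :- ((con 1ℚ :- d) :* (:- s :* y₀ :* y₁ :* x)))
               refl (δ j i) (pairSign i j) (Y (suc zero) i) (Y zero j) D ⟩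
    - ((1ℚ - δ j i) * (- pairSign i j * Y zero j * Y (suc zero) i * D))
      ≡⟨ cong (λ s → - ((1ℚ - δ j i) * (s * Y zero j * Y (suc zero) i * D))) (pairSign-antisym i≢j) ⟨
    - pairTerm Y j i
      ∎
    where
    open ≡-Reasoning
    D : ℚ
    D = det (λ r c → Y (suc (suc r)) (without j i c))

  det-swap₀₁ : ∀ {k} (Y : Mat (suc (suc k)) (suc (suc k))) → det (Y ∘ swap₀₁) ≡ - det Y
  det-swap₀₁ Y = begin
    det (Y ∘ swap₀₁)                                   ≡⟨ det-pairExpansion (Y ∘ swap₀₁) ⟩
    sumℚ (λ i → sumℚ (pairTerm (Y ∘ swap₀₁) i))        ≡⟨ sum-cong (λ i → sum-cong (pairTerm-swap₀₁ Y i)) ⟩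
    sumℚ (λ i → sumℚ (λ j → - pairTerm Y j i))         ≡⟨ sum-comm (λ i j → - pairTerm Y j i) ⟩
    sumℚ (λ j → sumℚ (λ i → - pairTerm Y j i))         ≡⟨ sum-cong (λ j → neg-distrib-sum (pairTerm Y j)) ⟨
    sumℚ (λ j → - sumℚ (pairTerm Y j))                 ≡⟨ neg-distrib-sum (λ j → sumℚ (pairTerm Y j)) ⟨
    - sumℚ (λ j → sumℚ (pairTerm Y j))                 ≡⟨ cong -_ (det-pairExpansion Y) ⟨
    - det Y                                            ∎
    where open ≡-Reasoning

  module _ {k} (f : Fin (suc k) → Fin (suc k)) (f₀≢fₛ : ∀ r → f zero ≢ f (suc r)) where

    -- f as a map Fin (suc k) ∖ {0} → Fin (suc k) ∖ {f 0}, both sides identified with Fin k.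
    shrink : Fin k → Fin k
    shrink r = punchOut (f₀≢fₛ r)

    punchIn-shrink : ∀ r → punchIn (f zero) (shrink r) ≡ f (suc r)
    punchIn-shrink r = punchIn-punchOut (f₀≢fₛ r)

  head-distinct : ∀ {k} {f : Fin (suc k) → Fin (suc k)} → Injective _≡_ _≡_ f → ∀ r → f zero ≢ f (suc r)
  head-distinct f-inj r f₀≡fₛ with f-inj f₀≡fₛ
  ... | ()

  det-∘-shrink : ∀ {k} (h : Fin (suc k) → Fin (suc k)) (h₀≢hₛ : ∀ r → h zero ≢ h (suc r)) (c : ℚ) →
                 (∀ Z → det (Z ∘ shrink h h₀≢hₛ) ≡ c * det Z) →
                 ∀ Y → det (Y ∘ h) ≡ c * sumℚ (λ j → -1^ toℕ j * Y (h zero) j * det (minor Y (h zero) j))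
  det-∘-shrink h h₀≢hₛ c reindex Y = begin
    sumℚ (λ j → -1^ toℕ j * Y (h zero) j * det (λ r l → Y (h (suc r)) (punchIn j l)))
      ≡⟨ sum-cong (λ j → cong (-1^ toℕ j * Y (h zero) j *_) (trans
           (det-cong λ r l → cong (λ t → Y t (punchIn j l)) (sym (punchIn-shrink h h₀≢hₛ r)))
           (reindex (minor Y (h zero) j)))) ⟩
    sumℚ (λ j → -1^ toℕ j * Y (h zero) j * (c * det (minor Y (h zero) j)))
      ≡⟨ sum-cong (λ j → solve 3 (λ a c d → a :* (c :* d) := c :* (a :* d)) refl
                                 (-1^ toℕ j * Y (h zero) j) c (det (minor Y (h zero) j))) ⟩
    sumℚ (λ j → c * (-1^ toℕ j * Y (h zero) j * det (minor Y (h zero) j)))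
      ≡⟨ *-distribˡ-sum c (λ j → -1^ toℕ j * Y (h zero) j * det (minor Y (h zero) j)) ⟨
    c * sumℚ (λ j → -1^ toℕ j * Y (h zero) j * det (minor Y (h zero) j))
      ∎
    where open ≡-Reasoning

  rotate : ∀ {k} → Fin (suc k) → Fin (suc k) → Fin (suc k)
  rotate a zero    = a
  rotate a (suc r) = punchIn a r

  det-rotate : ∀ {k} (a : Fin (suc k)) (Y : Mat (suc k) (suc k)) → det (Y ∘ rotate a) ≡ -1^ toℕ a * det Y
  det-rotate zero Y = trans (det-cong rows) (sym (ℚP.*-identityˡ (det Y)))
    where
    rows : ∀ i c → Y (rotate zero i) c ≡ Y i c
    rows zero    c = refl
    rows (suc r) c = refl
  det-rotate {suc k} (suc a) Y = begin
    det (Y ∘ rotate (suc a))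
      ≡⟨ det-cong rows ⟩
    det (Y ∘ lift 1 (rotate a) ∘ swap₀₁)
      ≡⟨ det-swap₀₁ (Y ∘ lift 1 (rotate a)) ⟩
    - det (Y ∘ lift 1 (rotate a))
      ≡⟨ cong -_ (det-∘-shrink (lift 1 (rotate a)) (λ _ ()) (-1^ toℕ a) (det-rotate a) Y) ⟩
    - (-1^ toℕ a * det Y)
      ≡⟨ ℚP.neg-distribˡ-* (-1^ toℕ a) (det Y) ⟩
    -1^ toℕ (suc a) * det Y
      ∎
    where
    open ≡-Reasoning
    rows : ∀ i c → Y (rotate (suc a) i) c ≡ Y (lift 1 (rotate a) (swap₀₁ i)) c
    rows zero          c = refl
    rows (suc zero)    c = refl
    rows (suc (suc r)) c = refl

  -- det (Y ∘ rotate a) unfolds to the Laplace expansion of det Y along row a.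
  laplace-row : ∀ {k} (a : Fin (suc k)) (Y : Mat (suc k) (suc k)) →
                sumℚ (λ j → -1^ toℕ j * Y a j * det (minor Y a j)) ≡ -1^ toℕ a * det Y
  laplace-row = det-rotate

  x≡-x⇒x≡0 : ∀ x → x ≡ - x → x ≡ 0ℚ
  x≡-x⇒x≡0 x x≡-x = begin
    x              ≡⟨ solve 1 (λ x → x := con ½ :* (x :+ x)) refl x ⟩
    ½ * (x + x)    ≡⟨ cong (λ y → ½ * (x + y)) x≡-x ⟩
    ½ * (x - x)    ≡⟨ cong (½ *_) (ℚP.+-inverseʳ x) ⟩
    ½ * 0ℚ         ≡⟨ ℚP.*-zeroʳ ½ ⟩
    0ℚ             ∎
    where open ≡-Reasoning

  det-equalFirstRows : ∀ {k} (W : Mat (suc (suc k)) (suc (suc k))) →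
                       (∀ c → W zero c ≡ W (suc zero) c) → det W ≡ 0ℚ
  det-equalFirstRows W row₀≗row₁ = x≡-x⇒x≡0 (det W) (trans (sym (det-cong rows)) (det-swap₀₁ W))
    where
    rows : ∀ i c → W (swap₀₁ i) c ≡ W i c
    rows zero          c = sym (row₀≗row₁ c)
    rows (suc zero)    c = row₀≗row₁ c
    rows (suc (suc r)) c = refl

  det-equalRows : ∀ {k} (Y : Mat (suc k) (suc k)) (s : Fin k) → (∀ c → Y zero c ≡ Y (suc s) c) → det Y ≡ 0ℚ
  det-equalRows {suc k} Y s row₀≗rowₛ = begin
    det Y
      ≡⟨ ℚP.*-identityˡ (det Y) ⟨
    1ℚ * det Y
      ≡⟨ cong (_* det Y) (-1^-square n) ⟨
    -1^ n * -1^ n * det Y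
      ≡⟨ ℚP.*-assoc (-1^ n) (-1^ n) (det Y) ⟩
    -1^ n * (-1^ n * det Y)
      ≡⟨ cong (-1^ n *_) (det-rotate (suc s) Y) ⟨
    -1^ n * det (Y ∘ rotate (suc s))
      ≡⟨ cong (-1^ n *_) (det-equalFirstRows (Y ∘ rotate (suc s)) (sym ∘ row₀≗rowₛ)) ⟩
    -1^ n * 0ℚ
      ≡⟨ ℚP.*-zeroʳ (-1^ n) ⟩
    0ℚ
      ∎
    where
    open ≡-Reasoning
    n : ℕ
    n = toℕ (suc s)

  det-reindexRows : ∀ {k} (h : Fin k → Fin k) (Y : Mat k k) → det (Y ∘ h) ≡ det (δ ∘ h) * det Y
  det-reindexRows {zero}  h Y = refl
  det-reindexRows {suc k} h Y with any? (λ r → h (suc r) ≟ h zero)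
  ... | yes (r , hᵣ≡h₀) = trans (vanish Y) (sym (trans (cong (_* det Y) (vanish δ)) (ℚP.*-zeroˡ (det Y))))
    where
    vanish : ∀ Z → det (Z ∘ h) ≡ 0ℚ
    vanish Z = det-equalRows (Z ∘ h) r (λ c → cong (λ t → Z t c) (sym hᵣ≡h₀))
  ... | no h-injective₀ = begin
    det (Y ∘ h)
      ≡⟨ expand Y ⟩
    det (δ ∘ h′) * (-1^ toℕ (h zero) * det Y)
      ≡⟨ solve 3 (λ a s d → a :* (s :* d) := a :* (s :* con 1ℚ) :* d) refl
                 (det (δ ∘ h′)) (-1^ toℕ (h zero)) (det Y) ⟩
    det (δ ∘ h′) * (-1^ toℕ (h zero) * 1ℚ) * det Y
      ≡⟨ cong (λ d → det (δ ∘ h′) * (-1^ toℕ (h zero) * d) * det Y) (det-identity {suc k}) ⟨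
    det (δ ∘ h′) * (-1^ toℕ (h zero) * det {suc k} δ) * det Y
      ≡⟨ cong (_* det Y) (expand δ) ⟨
    det (δ ∘ h) * det Y
      ∎
    where
    open ≡-Reasoning
    h₀≢hₛ : ∀ r → h zero ≢ h (suc r)
    h₀≢hₛ r h₀≡hᵣ = h-injective₀ (r , sym h₀≡hᵣ)
    h′ : Fin k → Fin k
    h′ = shrink h h₀≢hₛ
    expand : ∀ Z → det (Z ∘ h) ≡ det (δ ∘ h′) * (-1^ toℕ (h zero) * det Z)
    expand Z = trans (det-∘-shrink h h₀≢hₛ (det (δ ∘ h′)) (det-reindexRows h′) Z)
                     (cong (det (δ ∘ h′) *_) (laplace-row (h zero) Z))

  sumMaps : ∀ {k n} → ((Fin k → Fin n) → ℚ) → ℚ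
  sumMaps {zero}  F = F []
  sumMaps {suc k} F = sumℚ (λ a → sumMaps (λ g → F (a ∷ g)))

  sumMaps-cong : ∀ {k n} {F G : (Fin k → Fin n) → ℚ} → (∀ g → F g ≡ G g) → sumMaps F ≡ sumMaps G
  sumMaps-cong {zero}  F≗G = F≗G []
  sumMaps-cong {suc k} F≗G = sum-cong λ a → sumMaps-cong λ g → F≗G (a ∷ g)

  *-distribˡ-sumMaps : ∀ {k n} (x : ℚ) (F : (Fin k → Fin n) → ℚ) → x * sumMaps F ≡ sumMaps (λ g → x * F g)
  *-distribˡ-sumMaps {zero}  x F = refl
  *-distribˡ-sumMaps {suc k} x F =
    trans (*-distribˡ-sum x (λ a → sumMaps (λ g → F (a ∷ g))))
          (sum-cong λ a → *-distribˡ-sumMaps x (λ g → F (a ∷ g)))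

  *-distribʳ-sumMaps : ∀ {k n} (x : ℚ) (F : (Fin k → Fin n) → ℚ) → sumMaps F * x ≡ sumMaps (λ g → F g * x)
  *-distribʳ-sumMaps x F = begin
    sumMaps F * x                ≡⟨ ℚP.*-comm (sumMaps F) x ⟩
    x * sumMaps F                ≡⟨ *-distribˡ-sumMaps x F ⟩
    sumMaps (λ g → x * F g)      ≡⟨ sumMaps-cong (λ g → ℚP.*-comm x (F g)) ⟩
    sumMaps (λ g → F g * x)      ∎
    where open ≡-Reasoning

  sum-sumMaps-comm : ∀ {l k n} (F : Fin l → (Fin k → Fin n) → ℚ) →
                     sumℚ (λ j → sumMaps (F j)) ≡ sumMaps (λ g → sumℚ (λ j → F j g))
  sum-sumMaps-comm {k = zero}  F = refl
  sum-sumMaps-comm {k = suc k} F =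
    trans (sum-comm (λ j a → sumMaps (λ g → F j (a ∷ g))))
          (sum-cong λ a → sum-sumMaps-comm (λ j g → F j (a ∷ g)))

  det-expand : ∀ {k p} (X : Mat k p) (Y : Mat p k) →
               det (X ⊗ Y) ≡ sumMaps (λ h → prodℚ (λ i → X i (h i)) * det (Y ∘ h))
  det-expand {zero}      X Y = sym (ℚP.*-identityˡ 1ℚ)
  det-expand {suc k} {p} X Y = begin
    det (X ⊗ Y)
      ≡⟨ sum-cong (λ j → cong (-1^ toℕ j * (X ⊗ Y) zero j *_) (det-expand (X ∘ suc) (Yⱼ j))) ⟩
    sumℚ (λ j → -1^ toℕ j * (X ⊗ Y) zero j * sumMaps (λ h → Q h * D j h))
      ≡⟨ sum-cong distribute ⟩
    sumℚ (λ j → sumℚ (λ l → sumMaps (T j l)))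
      ≡⟨ sum-comm (λ j l → sumMaps (T j l)) ⟩
    sumℚ (λ l → sumℚ (λ j → sumMaps (T j l)))
      ≡⟨ sum-cong (λ l → sum-sumMaps-comm (λ j → T j l)) ⟩
    sumℚ (λ l → sumMaps (λ h → sumℚ (λ j → T j l h)))
      ≡⟨ sum-cong (λ l → sumMaps-cong (collect l)) ⟩
    sumℚ (λ l → sumMaps (λ h → X zero l * Q h * det (Y ∘ (l ∷ h))))
      ∎
    where
    open ≡-Reasoning
    Yⱼ : Fin (suc k) → Mat p k
    Yⱼ j l c = Y l (punchIn j c)
    Q : (Fin k → Fin p) → ℚ
    Q h = prodℚ (λ r → X (suc r) (h r))
    D : Fin (suc k) → (Fin k → Fin p) → ℚ
    D j h = det (Yⱼ j ∘ h)
    T : Fin (suc k) → Fin p → (Fin k → Fin p) → ℚ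
    T j l h = -1^ toℕ j * (X zero l * Y l j) * (Q h * D j h)
    distribute : ∀ j → -1^ toℕ j * (X ⊗ Y) zero j * sumMaps (λ h → Q h * D j h) ≡ sumℚ (λ l → sumMaps (T j l))
    distribute j = begin
      -1^ toℕ j * sumℚ (λ l → X zero l * Y l j) * S
        ≡⟨ cong (_* S) (*-distribˡ-sum (-1^ toℕ j) (λ l → X zero l * Y l j)) ⟩
      sumℚ (λ l → -1^ toℕ j * (X zero l * Y l j)) * S
        ≡⟨ *-distribʳ-sum S (λ l → -1^ toℕ j * (X zero l * Y l j)) ⟩
      sumℚ (λ l → -1^ toℕ j * (X zero l * Y l j) * S)
        ≡⟨ sum-cong (λ l → *-distribˡ-sumMaps (-1^ toℕ j * (X zero l * Y l j)) (λ h → Q h * D j h)) ⟩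
      sumℚ (λ l → sumMaps (T j l))
        ∎
      where
      S : ℚ
      S = sumMaps (λ h → Q h * D j h)
    collect : ∀ l h → sumℚ (λ j → T j l h) ≡ X zero l * Q h * det (Y ∘ (l ∷ h))
    collect l h = begin
      sumℚ (λ j → T j l h)
        ≡⟨ sum-cong (λ j → solve 5 (λ s x y q d → s :* (x :* y) :* (q :* d) := x :* q :* (s :* y :* d)) refl
                                   (-1^ toℕ j) (X zero l) (Y l j) (Q h) (D j h)) ⟩
      sumℚ (λ j → X zero l * Q h * (-1^ toℕ j * Y l j * D j h))
        ≡⟨ *-distribˡ-sum (X zero l * Q h) (λ j → -1^ toℕ j * Y l j * D j h) ⟨
      X zero l * Q h * det (Y ∘ (l ∷ h))
        ∎

  det-⊗ : ∀ {k} (X Y : Mat k k) → det (X ⊗ Y) ≡ det X * det Y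
  det-⊗ X Y = begin
    det (X ⊗ Y)
      ≡⟨ det-expand X Y ⟩
    sumMaps (λ h → P h * det (Y ∘ h))
      ≡⟨ sumMaps-cong (λ h → cong (P h *_) (det-reindexRows h Y)) ⟩
    sumMaps (λ h → P h * (det (δ ∘ h) * det Y))
      ≡⟨ sumMaps-cong (λ h → ℚP.*-assoc (P h) _ (det Y)) ⟨
    sumMaps (λ h → P h * det (δ ∘ h) * det Y)
      ≡⟨ *-distribʳ-sumMaps (det Y) (λ h → P h * det (δ ∘ h)) ⟨
    sumMaps (λ h → P h * det (δ ∘ h)) * det Y
      ≡⟨ cong (_* det Y) (det-expand X δ) ⟨
    det (X ⊗ δ) * det Y
      ≡⟨ cong (_* det Y) (det-cong (·-δ ∘ X)) ⟩
    det X * det Y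
      ∎
    where
    open ≡-Reasoning
    P : (Fin _ → Fin _) → ℚ
    P h = prodℚ (λ i → X i (h i))

  ⌊⌋ℕ-yes : ∀ {a} {A : Set a} (d : Dec A) → A → ⌊ d ⌋ℕ ≡ 1
  ⌊⌋ℕ-yes (yes _) _ = refl
  ⌊⌋ℕ-yes (no ¬a) a = ⊥-elim (¬a a)

  ⌊⌋ℕ-no : ∀ {a} {A : Set a} (d : Dec A) → ¬ A → ⌊ d ⌋ℕ ≡ 0
  ⌊⌋ℕ-no (yes a) ¬a = ⊥-elim (¬a a)
  ⌊⌋ℕ-no (no _)  _  = refl

  ⌊⌋ℕ-cong : ∀ {a b} {A : Set a} {B : Set b} (d : Dec A) (e : Dec B) →
             (A → B) → (B → A) → ⌊ d ⌋ℕ ≡ ⌊ e ⌋ℕ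
  ⌊⌋ℕ-cong (yes a) e A→B _   = sym (⌊⌋ℕ-yes e (A→B a))
  ⌊⌋ℕ-cong (no ¬a) e _   B→A = sym (⌊⌋ℕ-no e (¬a ∘ B→A))

  sumℕ-cong : ∀ {k} {f g : Fin k → ℕ} → (∀ i → f i ≡ g i) → sumℕ f ≡ sumℕ g
  sumℕ-cong {zero}  f≗g = refl
  sumℕ-cong {suc k} f≗g = cong₂ ℕ._+_ (f≗g zero) (sumℕ-cong (f≗g ∘ suc))

  sumℕ-zero : ∀ {k} (f : Fin k → ℕ) → (∀ i → f i ≡ 0) → sumℕ f ≡ 0
  sumℕ-zero {zero}  f f≗0 = refl
  sumℕ-zero {suc k} f f≗0 = cong₂ ℕ._+_ (f≗0 zero) (sumℕ-zero (f ∘ suc) (f≗0 ∘ suc))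

  sumℕ-punchIn : ∀ {k} (a : Fin (suc k)) (f : Fin (suc k) → ℕ) → sumℕ f ≡ f a ℕ.+ sumℕ (f ∘ punchIn a)
  sumℕ-punchIn          zero    f = refl
  sumℕ-punchIn {suc k} (suc a) f = begin
    f zero ℕ.+ sumℕ (f ∘ suc)
      ≡⟨ cong (f zero ℕ.+_) (sumℕ-punchIn a (f ∘ suc)) ⟩
    f zero ℕ.+ (f (suc a) ℕ.+ sumℕ (f ∘ suc ∘ punchIn a))
      ≡⟨ ℕP.+-assoc (f zero) _ _ ⟨
    f zero ℕ.+ f (suc a) ℕ.+ sumℕ (f ∘ suc ∘ punchIn a)
      ≡⟨ cong (ℕ._+ sumℕ (f ∘ suc ∘ punchIn a)) (ℕP.+-comm (f zero) _) ⟩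
    f (suc a) ℕ.+ f zero ℕ.+ sumℕ (f ∘ suc ∘ punchIn a)
      ≡⟨ ℕP.+-assoc (f (suc a)) _ _ ⟩
    f (suc a) ℕ.+ (f zero ℕ.+ sumℕ (f ∘ suc ∘ punchIn a))
      ∎
    where open ≡-Reasoning

  shrink-injective : ∀ {k} {f : Fin (suc k) → Fin (suc k)} (f-inj : Injective _≡_ _≡_ f) →
                     Injective _≡_ _≡_ (shrink f (head-distinct f-inj))
  shrink-injective f-inj {x} {y} eq with f-inj (punchOut-injective (head-distinct f-inj x) (head-distinct f-inj y) eq)
  ... | refl = refl

  sumℕ-reindex : ∀ {k} (f : Fin k → Fin k) → Injective _≡_ _≡_ f → (g : Fin k → ℕ) → sumℕ (g ∘ f) ≡ sumℕ g
  sumℕ-reindex {zero}  f f-inj g = refl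
  sumℕ-reindex {suc k} f f-inj g = begin
    g (f zero) ℕ.+ sumℕ (g ∘ f ∘ suc)
      ≡⟨ cong (g (f zero) ℕ.+_) (sumℕ-cong λ r → cong g (punchIn-shrink f f₀≢fₛ r)) ⟨
    g (f zero) ℕ.+ sumℕ (g ∘ punchIn (f zero) ∘ f′)
      ≡⟨ cong (g (f zero) ℕ.+_) (sumℕ-reindex f′ (shrink-injective f-inj) (g ∘ punchIn (f zero))) ⟩
    g (f zero) ℕ.+ sumℕ (g ∘ punchIn (f zero))
      ≡⟨ sumℕ-punchIn (f zero) g ⟨
    sumℕ g
      ∎
    where
    open ≡-Reasoning
    f₀≢fₛ : ∀ r → f zero ≢ f (suc r)
    f₀≢fₛ = head-distinct f-inj
    f′ : Fin k → Fin k
    f′ = shrink f f₀≢fₛ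

  [_<_] : ℕ → ℕ → ℕ
  [ a < b ] = ⌊ a ℕ.<? b ⌋ℕ

  [<]-suc : ∀ a b → [ suc a < suc b ] ≡ [ a < b ]
  [<]-suc a b = ⌊⌋ℕ-cong (suc a ℕ.<? suc b) (a ℕ.<? b) ℕ.s≤s⁻¹ ℕ.s≤s

  [<]-zeroʳ : ∀ a → [ a < 0 ] ≡ 0
  [<]-zeroʳ a = ⌊⌋ℕ-no (a ℕ.<? 0) λ ()

  [<]-zero-suc : ∀ b → [ 0 < suc b ] ≡ 1
  [<]-zero-suc b = ⌊⌋ℕ-yes (0 ℕ.<? suc b) ℕ.z<s

  [<]-irrefl : ∀ a → [ a < a ] ≡ 0
  [<]-irrefl a = ⌊⌋ℕ-no (a ℕ.<? a) (ℕP.<-irrefl refl)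

  count-below : ∀ {n} (a : Fin n) → sumℕ {n} (λ v → [ toℕ v < toℕ a ]) ≡ toℕ a
  count-below {suc n} zero    = sumℕ-zero {suc n} (λ v → [ toℕ v < 0 ]) (λ v → [<]-zeroʳ (toℕ v))
  count-below {suc n} (suc a) = cong₂ ℕ._+_ ([<]-zero-suc (toℕ a))
    (trans (sumℕ-cong {n} λ v → [<]-suc (toℕ v) (toℕ a)) (count-below a))

  punchIn-mono-< : ∀ {k} (a : Fin (suc k)) {u w : Fin k} → toℕ u ℕ.< toℕ w → toℕ (punchIn a u) ℕ.< toℕ (punchIn a w)
  punchIn-mono-< a {u} {w} u<w = ℕP.≰⇒> λ w′≤u′ → ℕP.<⇒≱ u<w (punchIn-cancel-≤ a w u w′≤u′)

  punchIn-cancel-< : ∀ {k} (a : Fin (suc k)) {u w : Fin k} → toℕ (punchIn a u) ℕ.< toℕ (punchIn a w) → toℕ u ℕ.< toℕ w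
  punchIn-cancel-< a {u} {w} u′<w′ = ℕP.≰⇒> λ w≤u → ℕP.<⇒≱ u′<w′ (punchIn-mono-≤ a w u w≤u)

  inversions-shrink : ∀ {k} (f : Fin (suc k) → Fin (suc k)) (f-inj : Injective _≡_ _≡_ f) →
                      inversions f ≡ toℕ (f zero) ℕ.+ inversions (shrink f (head-distinct f-inj))
  inversions-shrink {k} f f-inj = cong₂ ℕ._+_ firstRow (sumℕ-cong otherRow)
    where
    open ≡-Reasoning
    f₀≢fₛ : ∀ r → f zero ≢ f (suc r)
    f₀≢fₛ = head-distinct f-inj
    f′ : Fin k → Fin k
    f′ = shrink f f₀≢fₛ
    below₀ : Fin (suc k) → ℕ
    below₀ j = [ toℕ (f j) < toℕ (f zero) ]
    firstRow : sumℕ (λ j → [ 0 < toℕ j ] ℕ.* below₀ j) ≡ toℕ (f zero)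
    firstRow = begin
      [ 0 < 0 ] ℕ.* below₀ zero ℕ.+ sumℕ (λ j → [ 0 < suc (toℕ j) ] ℕ.* below₀ (suc j))
        ≡⟨ cong₂ ℕ._+_ (cong (ℕ._* below₀ zero) ([<]-irrefl 0))
                       (sumℕ-cong λ j → trans (cong (ℕ._* below₀ (suc j)) ([<]-zero-suc (toℕ j))) (ℕP.*-identityˡ _)) ⟩
      0 ℕ.+ sumℕ (below₀ ∘ suc)
        ≡⟨ cong (ℕ._+ sumℕ (below₀ ∘ suc)) ([<]-irrefl (toℕ (f zero))) ⟨
      sumℕ below₀
        ≡⟨ sumℕ-reindex f f-inj (λ v → [ toℕ v < toℕ (f zero) ]) ⟩
      sumℕ {suc k} (λ v → [ toℕ v < toℕ (f zero) ])
        ≡⟨ count-below (f zero) ⟩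
      toℕ (f zero)
        ∎
    shifted : ∀ i j → [ toℕ (f (suc j)) < toℕ (f (suc i)) ] ≡ [ toℕ (f′ j) < toℕ (f′ i) ]
    shifted i j = ⌊⌋ℕ-cong (toℕ (f (suc j)) ℕ.<? toℕ (f (suc i))) (toℕ (f′ j) ℕ.<? toℕ (f′ i))
      (λ lt → punchIn-cancel-< (f zero) (subst₂ _<ᶠ_ (sym (punchIn-f′ j)) (sym (punchIn-f′ i)) lt))
      (λ lt → subst₂ _<ᶠ_ (punchIn-f′ j) (punchIn-f′ i) (punchIn-mono-< (f zero) lt))
      where
      _<ᶠ_ : Fin (suc k) → Fin (suc k) → Set
      x <ᶠ y = toℕ x ℕ.< toℕ y
      punchIn-f′ : ∀ r → punchIn (f zero) (f′ r) ≡ f (suc r)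
      punchIn-f′ = punchIn-shrink f f₀≢fₛ
    otherRow : ∀ i → sumℕ (λ j → [ suc (toℕ i) < toℕ j ] ℕ.* [ toℕ (f j) < toℕ (f (suc i)) ])
                   ≡ sumℕ (λ j → [ toℕ i < toℕ j ] ℕ.* [ toℕ (f′ j) < toℕ (f′ i) ])
    otherRow i = cong₂ ℕ._+_ (cong (ℕ._* [ toℕ (f zero) < toℕ (f (suc i)) ]) ([<]-zeroʳ (suc (toℕ i))))
                             (sumℕ-cong λ j → cong₂ ℕ._*_ ([<]-suc (toℕ i) (toℕ j)) (shifted i j))

  det-permutation : ∀ {k} (f : Fin k → Fin k) → Injective _≡_ _≡_ f → det (δ ∘ f) ≡ -1^ inversions f
  det-permutation {zero}  f f-inj = refl
  det-permutation {suc k} f f-inj = begin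
    sumℚ (λ j → -1^ toℕ j * δ (f zero) j * det (minor (δ ∘ f) zero j))
      ≡⟨ sum-cong (λ j → solve 3 (λ s d x → s :* d :* x := d :* (s :* x)) refl
                                 (-1^ toℕ j) (δ (f zero) j) (det (minor (δ ∘ f) zero j))) ⟩
    sumℚ (λ j → δ (f zero) j * (-1^ toℕ j * det (minor (δ ∘ f) zero j)))
      ≡⟨ sum-δˡ (f zero) (λ j → -1^ toℕ j * det (minor (δ ∘ f) zero j)) ⟩
    -1^ toℕ (f zero) * det (minor (δ ∘ f) zero (f zero))
      ≡⟨ cong (-1^ toℕ (f zero) *_) (det-cong minor≗) ⟩
    -1^ toℕ (f zero) * det (δ ∘ f′)
      ≡⟨ cong (-1^ toℕ (f zero) *_) (det-permutation f′ (shrink-injective f-inj)) ⟩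
    -1^ toℕ (f zero) * -1^ inversions f′
      ≡⟨ -1^-+ (toℕ (f zero)) (inversions f′) ⟨
    -1^ (toℕ (f zero) ℕ.+ inversions f′)
      ≡⟨ cong -1^_ (inversions-shrink f f-inj) ⟨
    -1^ inversions f
      ∎
    where
    open ≡-Reasoning
    f′ : Fin k → Fin k
    f′ = shrink f (head-distinct f-inj)
    minor≗ : ∀ r c → δ (f (suc r)) (punchIn (f zero) c) ≡ δ (f′ r) c
    minor≗ r c = trans (cong (λ t → δ t (punchIn (f zero) c)) (sym (punchIn-shrink f (head-distinct f-inj) r)))
                       (δ-punchIn-punchIn (f zero) (f′ r) c)

  trace : ∀ {p} → Mat p p → ℚ
  trace M = sumℚ (λ i → M i i)

  trace-⊗-comm : ∀ {p q} (X : Mat p q) (Y : Mat q p) → trace (X ⊗ Y) ≡ trace (Y ⊗ X)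
  trace-⊗-comm X Y =
    trans (sum-comm (λ i j → X i j * Y j i)) (sum-cong λ j → sum-cong λ i → ℚP.*-comm (X i j) (Y j i))

  dim : ℕ → ℚ
  dim p = sumℚ {p} (λ _ → 1ℚ)

  trace-identity : ∀ {p} (M : Mat p p) → (∀ i j → M i j ≡ δ i j) → trace M ≡ dim p
  trace-identity M M≗I = sum-cong λ i → trans (M≗I i i) (δ-refl i)

  dim-nonNeg : ∀ p → 0ℚ ℚ.≤ dim p
  dim-nonNeg zero    = ℚP.≤-refl
  dim-nonNeg (suc p) = ℚP.+-mono-≤ {0ℚ} {1ℚ} (ℚ.*≤* (ℤ.+≤+ ℕ.z≤n)) (dim-nonNeg p)

  dim-pos : ∀ p → 0ℚ ℚ.< dim (suc p)
  dim-pos p = ℚP.+-mono-<-≤ {0ℚ} {1ℚ} (ℚ.*<* (ℤ.+<+ ℕ.z<s)) (dim-nonNeg p)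

  dim-injective : ∀ {p q} → dim p ≡ dim q → p ≡ q
  dim-injective {zero}  {zero}  _ = refl
  dim-injective {zero}  {suc q} e = ⊥-elim (ℚP.<-irrefl e (dim-pos q))
  dim-injective {suc p} {zero}  e = ⊥-elim (ℚP.<-irrefl (sym e) (dim-pos p))
  dim-injective {suc p} {suc q} e = cong suc (dim-injective (+-cancelˡ 1ℚ (dim p) (dim q) e))

  ⊗-inverse⇒square : ∀ {p q} (X : Mat p q) (Y : Mat q p) →
                     (∀ i j → (X ⊗ Y) i j ≡ δ i j) → (∀ i j → (Y ⊗ X) i j ≡ δ i j) → p ≡ q
  ⊗-inverse⇒square {p} {q} X Y XY≗I YX≗I = dim-injective (begin
    dim p              ≡⟨ trace-identity (X ⊗ Y) XY≗I ⟨
    trace (X ⊗ Y)      ≡⟨ trace-⊗-comm X Y ⟩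
    trace (Y ⊗ X)      ≡⟨ trace-identity (Y ⊗ X) YX≗I ⟩
    dim q              ∎)
    where open ≡-Reasoning

  det-similar : ∀ {p q} (X : Mat p q) (Y : Mat q p) (N : Mat p p) (T : Mat q q) →
                (∀ i j → (X ⊗ Y) i j ≡ δ i j) → (∀ i j → (Y ⊗ X) i j ≡ δ i j) →
                (∀ i j → (X ⊗ T) i j ≡ (N ⊗ X) i j) → det N ≡ det T
  det-similar {p} {q} X Y N T XY≗I YX≗I XT≗NX with ⊗-inverse⇒square X Y XY≗I YX≗I
  ... | refl = begin
    det N
      ≡⟨ ℚP.*-identityʳ (det N) ⟨
    det N * 1ℚ
      ≡⟨ cong (det N *_) detXdetY≡1 ⟨
    det N * (det X * det Y)
      ≡⟨ solve 3 (λ n x y → n :* (x :* y) := n :* x :* y) refl (det N) (det X) (det Y) ⟩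
    det N * det X * det Y
      ≡⟨ cong (_* det Y) (trans (sym (det-⊗ N X)) (trans (det-cong (λ i j → sym (XT≗NX i j))) (det-⊗ X T))) ⟩
    det X * det T * det Y
      ≡⟨ solve 3 (λ t x y → x :* t :* y := t :* (x :* y)) refl (det T) (det X) (det Y) ⟩
    det T * (det X * det Y)
      ≡⟨ cong (det T *_) detXdetY≡1 ⟩
    det T * 1ℚ
      ≡⟨ ℚP.*-identityʳ (det T) ⟩
    det T
      ∎
    where
    open ≡-Reasoning
    detXdetY≡1 : det X * det Y ≡ 1ℚ
    detXdetY≡1 = trans (sym (det-⊗ X Y)) (trans (det-cong XY≗I) (det-identity {p}))

  infix 4 _≈±_

  data _≈±_ : ℤ → ℚ → Set where
    plus  : ℤ.1ℤ ≈± 1ℚ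
    minus : ℤ.-1ℤ ≈± - 1ℚ

  ≈±-* : ∀ {u v q r} → u ≈± q → v ≈± r → u ℤ.* v ≈± q * r
  ≈±-* plus  plus  = plus
  ≈±-* plus  minus = minus
  ≈±-* minus plus  = minus
  ≈±-* minus minus = plus

  ≈±-neg : ∀ {u q} → u ≈± q → ℤ.- u ≈± - q
  ≈±-neg plus  = minus
  ≈±-neg minus = plus

  ≈±-square : ∀ {u q} → u ≈± q → u ℤ.* u ≡ ℤ.1ℤ
  ≈±-square plus  = refl
  ≈±-square minus = refl

  signℚ-≈± : ∀ {u q} → u ≈± q → signℚ q ≡ u
  signℚ-≈± plus  = refl
  signℚ-≈± minus = refl

  negOnePow≈±-1^ : ∀ n → negOnePow n ≈± -1^ n
  negOnePow≈±-1^ zero    = plus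
  negOnePow≈±-1^ (suc n) = ≈±-neg (negOnePow≈±-1^ n)

  prod≈± : ∀ {k} (u : Fin k → ℤ) (q : Fin k → ℚ) → (∀ i → u i ≈± q i) → prodℤ u ≈± prodℚ q
  prod≈± {zero}  u q u≈q = plus
  prod≈± {suc k} u q u≈q = ≈±-* (u≈q zero) (prod≈± (u ∘ suc) (q ∘ suc) (u≈q ∘ suc))

  infixl 6 _⊕_

  _⊕_ : ∀ {p q} → Mat p q → Mat p q → Mat p q
  (X ⊕ Y) i j = X i j + Y i j

  𝟎 : ∀ {p q} → Mat p q
  𝟎 _ _ = 0ℚ

  blocks : ∀ {a e c d} → Mat a c → Mat a d → Mat e c → Mat e d → Mat (a ℕ.+ e) (c ℕ.+ d)
  blocks {a} {c = c} P Q R S i j =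
    [ (λ i′ → [ P i′ , Q i′ ]′ (splitAt c j)) , (λ i′ → [ R i′ , S i′ ]′ (splitAt c j)) ]′ (splitAt a i)

  module _ {a e c d} (P : Mat a c) (Q : Mat a d) (R : Mat e c) (S : Mat e d) where

    blocks-↑ˡ↑ˡ : ∀ i j → blocks P Q R S (i ↑ˡ e) (j ↑ˡ d) ≡ P i j
    blocks-↑ˡ↑ˡ i j rewrite splitAt-↑ˡ a i e | splitAt-↑ˡ c j d = refl

    blocks-↑ˡ↑ʳ : ∀ i j → blocks P Q R S (i ↑ˡ e) (c ↑ʳ j) ≡ Q i j
    blocks-↑ˡ↑ʳ i j rewrite splitAt-↑ˡ a i e | splitAt-↑ʳ c d j = refl

    blocks-↑ʳ↑ˡ : ∀ i j → blocks P Q R S (a ↑ʳ i) (j ↑ˡ d) ≡ R i j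
    blocks-↑ʳ↑ˡ i j rewrite splitAt-↑ʳ a e i | splitAt-↑ˡ c j d = refl

    blocks-↑ʳ↑ʳ : ∀ i j → blocks P Q R S (a ↑ʳ i) (c ↑ʳ j) ≡ S i j
    blocks-↑ʳ↑ʳ i j rewrite splitAt-↑ʳ a e i | splitAt-↑ʳ c d j = refl

  ↑-elim : ∀ {a e} (F : Fin (a ℕ.+ e) → Set) → (∀ i → F (i ↑ˡ e)) → (∀ j → F (a ↑ʳ j)) → ∀ x → F x
  ↑-elim {a} {e} F f g x = subst F (join-splitAt a e x) ([_,_] {C = F ∘ join a e} f g (splitAt a x))

  blocks-ext : ∀ {a e c d} (X Y : Mat (a ℕ.+ e) (c ℕ.+ d)) →
    (∀ i j → X (i ↑ˡ e) (j ↑ˡ d) ≡ Y (i ↑ˡ e) (j ↑ˡ d)) →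
    (∀ i j → X (i ↑ˡ e) (c ↑ʳ j) ≡ Y (i ↑ˡ e) (c ↑ʳ j)) →
    (∀ i j → X (a ↑ʳ i) (j ↑ˡ d) ≡ Y (a ↑ʳ i) (j ↑ˡ d)) →
    (∀ i j → X (a ↑ʳ i) (c ↑ʳ j) ≡ Y (a ↑ʳ i) (c ↑ʳ j)) →
    ∀ x y → X x y ≡ Y x y
  blocks-ext {a} {e} {c} {d} X Y ≡₁₁ ≡₁₂ ≡₂₁ ≡₂₂ =
    ↑-elim (λ x → ∀ y → X x y ≡ Y x y)
      (λ i → ↑-elim (λ y → X (i ↑ˡ e) y ≡ Y (i ↑ˡ e) y) (≡₁₁ i) (≡₁₂ i))
      (λ i → ↑-elim (λ y → X (a ↑ʳ i) y ≡ Y (a ↑ʳ i) y) (≡₂₁ i) (≡₂₂ i))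

  δ-↑ˡ↑ˡ : ∀ {a} e (i j : Fin a) → δ (i ↑ˡ e) (j ↑ˡ e) ≡ δ i j
  δ-↑ˡ↑ˡ e zero    zero    = refl
  δ-↑ˡ↑ˡ e zero    (suc j) = refl
  δ-↑ˡ↑ˡ e (suc i) zero    = refl
  δ-↑ˡ↑ˡ e (suc i) (suc j) = δ-↑ˡ↑ˡ e i j

  δ-↑ˡ↑ʳ : ∀ {a e} (i : Fin a) (j : Fin e) → δ (i ↑ˡ e) (a ↑ʳ j) ≡ 0ℚ
  δ-↑ˡ↑ʳ zero    j = refl
  δ-↑ˡ↑ʳ (suc i) j = δ-↑ˡ↑ʳ i j

  δ-↑ʳ↑ˡ : ∀ {a e} (i : Fin e) (j : Fin a) → δ (a ↑ʳ i) (j ↑ˡ e) ≡ 0ℚ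
  δ-↑ʳ↑ˡ {a} {e} i j = trans (δ-sym (a ↑ʳ i) (j ↑ˡ e)) (δ-↑ˡ↑ʳ j i)

  δ-↑ʳ↑ʳ : ∀ a {e} (i j : Fin e) → δ (a ↑ʳ i) (a ↑ʳ j) ≡ δ i j
  δ-↑ʳ↑ʳ zero    i j = refl
  δ-↑ʳ↑ʳ (suc a) i j = δ-↑ʳ↑ʳ a i j

  δ-blocks : ∀ {a e} x y → δ x y ≡ blocks {a} {e} δ 𝟎 𝟎 δ x y
  δ-blocks {a} {e} = blocks-ext {a} {e} δ (blocks {a} {e} δ 𝟎 𝟎 δ)
    (λ i j → trans (δ-↑ˡ↑ˡ e i j) (sym (blocks-↑ˡ↑ˡ δ 𝟎 𝟎 δ i j)))
    (λ i j → trans (δ-↑ˡ↑ʳ i j) (sym (blocks-↑ˡ↑ʳ δ 𝟎 𝟎 δ i j)))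
    (λ i j → trans (δ-↑ʳ↑ˡ i j) (sym (blocks-↑ʳ↑ˡ δ 𝟎 𝟎 δ i j)))
    (λ i j → trans (δ-↑ʳ↑ʳ a i j) (sym (blocks-↑ʳ↑ʳ {a} δ 𝟎 𝟎 δ i j)))

  blocks-cong : ∀ {a e c d} {P P′ : Mat a c} {Q Q′ : Mat a d} {R R′ : Mat e c} {S S′ : Mat e d} →
    (∀ i j → P i j ≡ P′ i j) → (∀ i j → Q i j ≡ Q′ i j) →
    (∀ i j → R i j ≡ R′ i j) → (∀ i j → S i j ≡ S′ i j) →
    ∀ x y → blocks P Q R S x y ≡ blocks P′ Q′ R′ S′ x y
  blocks-cong {a} {c = c} P≗ Q≗ R≗ S≗ x y with splitAt a x | splitAt c y
  ... | inj₁ i | inj₁ j = P≗ i j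
  ... | inj₁ i | inj₂ j = Q≗ i j
  ... | inj₂ i | inj₁ j = R≗ i j
  ... | inj₂ i | inj₂ j = S≗ i j

  sum-↑-cong : ∀ {c d} (f : Fin (c ℕ.+ d) → ℚ) {g : Fin c → ℚ} {h : Fin d → ℚ} →
               (∀ k → f (k ↑ˡ d) ≡ g k) → (∀ k → f (c ↑ʳ k) ≡ h k) → sumℚ f ≡ sumℚ g + sumℚ h
  sum-↑-cong {c} f f≗g f≗h = trans (sum-↑ {c} f) (cong₂ _+_ (sum-cong f≗g) (sum-cong f≗h))

  ⊗-blocks : ∀ {a e c d a′ e′} (P : Mat a c) (Q : Mat a d) (R : Mat e c) (S : Mat e d)
               (P′ : Mat c a′) (Q′ : Mat c e′) (R′ : Mat d a′) (S′ : Mat d e′) → ∀ x y →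
             (blocks P Q R S ⊗ blocks P′ Q′ R′ S′) x y ≡
             blocks (P ⊗ P′ ⊕ Q ⊗ R′) (P ⊗ Q′ ⊕ Q ⊗ S′) (R ⊗ P′ ⊕ S ⊗ R′) (R ⊗ Q′ ⊕ S ⊗ S′) x y
  ⊗-blocks {a} {e} {c} {d} {a′} {e′} P Q R S P′ Q′ R′ S′ = blocks-ext (X ⊗ Y) Z
    (λ i j → trans (sum-↑-cong (λ k → X (i ↑ˡ e) k * Y k (j ↑ˡ e′))
                     (λ k → cong₂ _*_ (blocks-↑ˡ↑ˡ P Q R S i k) (blocks-↑ˡ↑ˡ P′ Q′ R′ S′ k j))
                     (λ k → cong₂ _*_ (blocks-↑ˡ↑ʳ P Q R S i k) (blocks-↑ʳ↑ˡ P′ Q′ R′ S′ k j)))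
                   (sym (blocks-↑ˡ↑ˡ Z₁₁ Z₁₂ Z₂₁ Z₂₂ i j)))
    (λ i j → trans (sum-↑-cong (λ k → X (i ↑ˡ e) k * Y k (a′ ↑ʳ j))
                     (λ k → cong₂ _*_ (blocks-↑ˡ↑ˡ P Q R S i k) (blocks-↑ˡ↑ʳ P′ Q′ R′ S′ k j))
                     (λ k → cong₂ _*_ (blocks-↑ˡ↑ʳ P Q R S i k) (blocks-↑ʳ↑ʳ P′ Q′ R′ S′ k j)))
                   (sym (blocks-↑ˡ↑ʳ Z₁₁ Z₁₂ Z₂₁ Z₂₂ i j)))
    (λ i j → trans (sum-↑-cong (λ k → X (a ↑ʳ i) k * Y k (j ↑ˡ e′))
                     (λ k → cong₂ _*_ (blocks-↑ʳ↑ˡ P Q R S i k) (blocks-↑ˡ↑ˡ P′ Q′ R′ S′ k j))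
                     (λ k → cong₂ _*_ (blocks-↑ʳ↑ʳ P Q R S i k) (blocks-↑ʳ↑ˡ P′ Q′ R′ S′ k j)))
                   (sym (blocks-↑ʳ↑ˡ Z₁₁ Z₁₂ Z₂₁ Z₂₂ i j)))
    (λ i j → trans (sum-↑-cong (λ k → X (a ↑ʳ i) k * Y k (a′ ↑ʳ j))
                     (λ k → cong₂ _*_ (blocks-↑ʳ↑ˡ P Q R S i k) (blocks-↑ˡ↑ʳ P′ Q′ R′ S′ k j))
                     (λ k → cong₂ _*_ (blocks-↑ʳ↑ʳ P Q R S i k) (blocks-↑ʳ↑ʳ P′ Q′ R′ S′ k j)))
                   (sym (blocks-↑ʳ↑ʳ Z₁₁ Z₁₂ Z₂₁ Z₂₂ i j)))
    where
    X : Mat (a ℕ.+ e) (c ℕ.+ d)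
    X = blocks P Q R S
    Y : Mat (c ℕ.+ d) (a′ ℕ.+ e′)
    Y = blocks P′ Q′ R′ S′
    Z₁₁ : Mat a a′
    Z₁₁ = P ⊗ P′ ⊕ Q ⊗ R′
    Z₁₂ : Mat a e′
    Z₁₂ = P ⊗ Q′ ⊕ Q ⊗ S′
    Z₂₁ : Mat e a′
    Z₂₁ = R ⊗ P′ ⊕ S ⊗ R′
    Z₂₂ : Mat e e′
    Z₂₂ = R ⊗ Q′ ⊕ S ⊗ S′
    Z : Mat (a ℕ.+ e) (a′ ℕ.+ e′)
    Z = blocks Z₁₁ Z₁₂ Z₂₁ Z₂₂

  -- Spelling out blocks-cong's implicit arguments keeps unification from unfolding ℚ arithmetic.
  ⊗-blocks≗δ : ∀ {a e c d} (P : Mat a c) (Q : Mat a d) (R : Mat e c) (S : Mat e d)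
                 (P′ : Mat c a) (Q′ : Mat c e) (R′ : Mat d a) (S′ : Mat d e) →
               (∀ i j → (P ⊗ P′ ⊕ Q ⊗ R′) i j ≡ δ i j) → (∀ i j → (P ⊗ Q′ ⊕ Q ⊗ S′) i j ≡ 0ℚ) →
               (∀ i j → (R ⊗ P′ ⊕ S ⊗ R′) i j ≡ 0ℚ)  → (∀ i j → (R ⊗ Q′ ⊕ S ⊗ S′) i j ≡ δ i j) →
               ∀ x y → (blocks P Q R S ⊗ blocks P′ Q′ R′ S′) x y ≡ δ x y
  ⊗-blocks≗δ {a} {e} P Q R S P′ Q′ R′ S′ ≗₁₁ ≗₁₂ ≗₂₁ ≗₂₂ x y =
    trans (⊗-blocks P Q R S P′ Q′ R′ S′ x y)
          (trans (blocks-cong {P = P ⊗ P′ ⊕ Q ⊗ R′} {δ} {P ⊗ Q′ ⊕ Q ⊗ S′} {𝟎}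
                              {R ⊗ P′ ⊕ S ⊗ R′} {𝟎} {R ⊗ Q′ ⊕ S ⊗ S′} {δ} ≗₁₁ ≗₁₂ ≗₂₁ ≗₂₂ x y)
                 (sym (δ-blocks {a} {e} x y)))

  ⊗-blocks-cong : ∀ {a e c d a′ e′ c′ d′}
    (P : Mat a c) (Q : Mat a d) (R : Mat e c) (S : Mat e d)
    (P′ : Mat c a′) (Q′ : Mat c e′) (R′ : Mat d a′) (S′ : Mat d e′)
    (U : Mat a c′) (V : Mat a d′) (W : Mat e c′) (X : Mat e d′)
    (U′ : Mat c′ a′) (V′ : Mat c′ e′) (W′ : Mat d′ a′) (X′ : Mat d′ e′) →
    (∀ i j → (P ⊗ P′ ⊕ Q ⊗ R′) i j ≡ (U ⊗ U′ ⊕ V ⊗ W′) i j) →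
    (∀ i j → (P ⊗ Q′ ⊕ Q ⊗ S′) i j ≡ (U ⊗ V′ ⊕ V ⊗ X′) i j) →
    (∀ i j → (R ⊗ P′ ⊕ S ⊗ R′) i j ≡ (W ⊗ U′ ⊕ X ⊗ W′) i j) →
    (∀ i j → (R ⊗ Q′ ⊕ S ⊗ S′) i j ≡ (W ⊗ V′ ⊕ X ⊗ X′) i j) →
    ∀ x y → (blocks P Q R S ⊗ blocks P′ Q′ R′ S′) x y ≡ (blocks U V W X ⊗ blocks U′ V′ W′ X′) x y
  ⊗-blocks-cong P Q R S P′ Q′ R′ S′ U V W X U′ V′ W′ X′ ≗₁₁ ≗₁₂ ≗₂₁ ≗₂₂ x y =
    trans (⊗-blocks P Q R S P′ Q′ R′ S′ x y)
          (trans (blocks-cong {P = P ⊗ P′ ⊕ Q ⊗ R′} {U ⊗ U′ ⊕ V ⊗ W′} {P ⊗ Q′ ⊕ Q ⊗ S′} {U ⊗ V′ ⊕ V ⊗ X′}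
                              {R ⊗ P′ ⊕ S ⊗ R′} {W ⊗ U′ ⊕ X ⊗ W′} {R ⊗ Q′ ⊕ S ⊗ S′} {W ⊗ V′ ⊕ X ⊗ X′}
                              ≗₁₁ ≗₁₂ ≗₂₁ ≗₂₂ x y)
                 (sym (⊗-blocks U V W X U′ V′ W′ X′ x y)))

  𝟏 : ∀ {p q} → Mat p q
  𝟏 _ _ = 1ℚ

  𝟎⊗ : ∀ {p q r} (Y : Mat q r) i j → (𝟎 {p} ⊗ Y) i j ≡ 0ℚ
  𝟎⊗ Y i = ·-zeroˡ Y (λ _ → refl)

  ⊗𝟎 : ∀ {p q r} (X : Mat p q) i j → (X ⊗ 𝟎 {q} {r}) i j ≡ 0ℚ
  ⊗𝟎 X i j = ·-zeroʳ (X i) j (λ _ → refl)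

  det-blocks : ∀ {a c} (P : Mat a a) (R : Mat c a) (S : Mat c c) → det (blocks P 𝟎 R S) ≡ det P * det S
  det-blocks P R S = trans (det-blockTriangular (blocks P 𝟎 R S) (blocks-↑ˡ↑ʳ P 𝟎 R S))
                           (cong₂ _*_ (det-cong (blocks-↑ˡ↑ˡ P 𝟎 R S)) (det-cong (blocks-↑ʳ↑ʳ P 𝟎 R S)))

module GraphHomology where

  open import Defs
  open import Data.Nat as ℕ using (ℕ)
  open import Data.Fin using (Fin; zero)
  open import Data.Fin.Properties using (_≟_)
  open import Data.Bool using (Bool; true; false; not)
  open import Data.Bool.Properties using (¬-not)
  import Data.Bool.Properties as BoolP
  open import Data.Product using (Σ; _×_; _,_; proj₁; proj₂)
  open import Data.Integer as ℤ using (ℤ)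
  import Data.Integer.Properties as ℤP
  open import Data.Rational using (ℚ; 0ℚ; 1ℚ; _+_; _*_; -_; _-_)
  import Data.Rational.Properties as ℚP
  open import Data.Rational.Solver using (module +-*-Solver)
  open import Function using (_∘_)
  open import Function.Definitions using (Injective)
  open import Function.Bundles using (Inverse; Injection)
  open import Function.Properties.Inverse using (↔⇒↣)
  open import Relation.Binary.PropositionalEquality
  open import Relation.Nullary using (yes; no)

  open +-*-Solver
  open LinearAlgebra

  module _ (G : Multigraph) where
    open Multigraph G

    ∂ : Mat m n
    ∂ e v = δ (head e) v - δ (tail e) v

    ind≡δ : ∀ a b → ind G a b ≡ δ a b
    ind≡δ a b with a ≟ b
    ... | yes refl = sym (δ-refl a)
    ... | no a≢b   = sym (δ-≢ a≢b)

    boundary≡·∂ : ∀ z v → boundary G z v ≡ (z · ∂) v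
    boundary≡·∂ z v = sum-cong λ e → cong₂ (λ x y → z e * (x - y)) (ind≡δ (head e) v) (ind≡δ (tail e) v)

    sum-∂ : ∀ e → sumℚ (∂ e) ≡ 0ℚ
    sum-∂ e = trans (sum-distrib-− (δ (head e)) (δ (tail e)))
                    (trans (cong₂ _-_ (sum-δ (head e)) (sum-δ (tail e))) (ℚP.+-inverseʳ 1ℚ))

  module _ {G : Multigraph} (P : Aut G) where
    open Multigraph G
    open Aut P

    σ : Fin n → Fin n
    σ = Inverse.to PV

    H : Fin m × Bool → Fin m × Bool
    H = Inverse.to PH

    π : Fin m → Fin m
    π = PEfun G P

    flipped : Fin m → Bool
    flipped e = proj₂ (H (e , false))

    σ-injective : Injective _≡_ _≡_ σ
    σ-injective = Injection.injective (↔⇒↣ PV)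

    H-injective : Injective _≡_ _≡_ H
    H-injective = Injection.injective (↔⇒↣ PH)

    H-head : ∀ e → H (e , true) ≡ (π e , not (flipped e))
    H-head e = cong₂ _,_ (sym (edgeCompat e)) (¬-not λ same → head≢tail (H-injective (cong₂ _,_ (sym (edgeCompat e)) same)))
      where
      head≢tail : (e , true) ≢ (e , false)
      head≢tail ()

    π-injective : Injective _≡_ _≡_ π
    π-injective {e} {e′} πe≡πe′ with flipped e BoolP.≟ flipped e′
    ... | yes same  = cong proj₁ (H-injective (cong₂ _,_ πe≡πe′ same))
    ... | no differ with H-injective (trans (H-head e) (cong₂ _,_ πe≡πe′ (sym (¬-not (differ ∘ sym)))))
    ...   | ()

    attach-π : ∀ {e b} → flipped e ≡ b → attach (π e , b) ≡ σ (tail e)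
    attach-π {e} refl = attachCompat (e , false)

    attach-π-not : ∀ {e b} → flipped e ≡ b → attach (π e , not b) ≡ σ (head e)
    attach-π-not {e} refl = trans (cong attach (sym (H-head e))) (attachCompat (e , true))

    ε-∂-π : ∀ e w → εℚ G P e * ∂ G (π e) w ≡ δ (σ (head e)) w - δ (σ (tail e)) w
    ε-∂-π e w with flipped e in eq
    ... | false = trans (ℚP.*-identityˡ (∂ G (π e) w)) (cong₂ (λ h t → δ h w - δ t w) (attach-π-not eq) (attach-π eq))
    ... | true  = trans (cong₂ (λ h t → - 1ℚ * (δ h w - δ t w)) (attach-π eq) (attach-π-not eq))
      (solve 2 (λ x y → :- con 1ℚ :* (x :- y) := y :- x) refl (δ (σ (tail e)) w) (δ (σ (head e)) w))

    A : Mat m m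
    A e f = εℚ G P e * δ (π e) f

    ∂-equivariant : ∀ e w → (A ⊗ ∂ G) e w ≡ (∂ G ⊗ (δ ∘ σ)) e w
    ∂-equivariant e w = begin
      sumℚ (λ f → εℚ G P e * δ (π e) f * ∂ G f w)
        ≡⟨ sum-cong (λ f → ℚP.*-assoc (εℚ G P e) (δ (π e) f) (∂ G f w)) ⟩
      sumℚ (λ f → εℚ G P e * (δ (π e) f * ∂ G f w))
        ≡⟨ *-distribˡ-sum (εℚ G P e) (λ f → δ (π e) f * ∂ G f w) ⟨
      εℚ G P e * (δ (π e) · ∂ G) w
        ≡⟨ cong (εℚ G P e *_) (δ-· (π e) (∂ G) w) ⟩
      εℚ G P e * ∂ G (π e) w
        ≡⟨ ε-∂-π e w ⟩
      δ (σ (head e)) w - δ (σ (tail e)) w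
        ≡⟨ cong₂ _-_ (δ-· (head e) (δ ∘ σ) w) (δ-· (tail e) (δ ∘ σ) w) ⟨
      (δ (head e) · (δ ∘ σ)) w - (δ (tail e) · (δ ∘ σ)) w
        ≡⟨ ·-distribʳ-− (δ (head e)) (δ (tail e)) (δ ∘ σ) w ⟨
      (∂ G e · (δ ∘ σ)) w
        ∎
      where open ≡-Reasoning

    private
      chainSummand : Σ ((Fin m → ℚ) → Fin m → Fin m → ℚ) λ t → ∀ z f → PE-chain G P z f ≡ sumℚ (t z f)
      chainSummand = _ , λ z f → refl

      -- PE-chain is written with a Kronecker delta local to its where block; chainSummand exposes it.
      chainSummand-δ : ∀ z f e → proj₁ chainSummand z f e ≡ δ (π e) f * (εℚ G P e * z e)
      chainSummand-δ z f e with PEfun G P e ≟ f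
      ... | yes refl = cong (_* (εℚ G P e * z e)) (sym (δ-refl (π e)))
      ... | no πe≢f  = cong (_* (εℚ G P e * z e)) (sym (δ-≢ πe≢f))

    PE-chain≡·A : ∀ z f → PE-chain G P z f ≡ (z · A) f
    PE-chain≡·A z f = trans (proj₂ chainSummand z f) (sum-cong λ e →
      trans (chainSummand-δ z f e)
            (solve 3 (λ d x y → d :* (x :* y) := y :* (x :* d)) refl (δ (π e) f) (εℚ G P e) (z e)))

    det-A : det A ≡ prodℚ (εℚ G P) * -1^ inversions π
    det-A = begin
      det A                                  ≡⟨ det-cong (λ e f → sym (diagonal⊗permutation e f)) ⟩
      det (D ⊗ (δ ∘ π))                      ≡⟨ det-⊗ D (δ ∘ π) ⟩
      det D * det (δ ∘ π)                    ≡⟨ cong₂ _*_ (det-diagonal (εℚ G P)) (det-permutation π π-injective) ⟩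
      prodℚ (εℚ G P) * -1^ inversions π      ∎
      where
      open ≡-Reasoning
      D : Mat m m
      D e g = εℚ G P e * δ e g
      diagonal⊗permutation : ∀ e f → (D ⊗ (δ ∘ π)) e f ≡ A e f
      diagonal⊗permutation e f = begin
        sumℚ (λ g → εℚ G P e * δ e g * δ (π g) f)
          ≡⟨ sum-cong (λ g → ℚP.*-assoc (εℚ G P e) (δ e g) (δ (π g) f)) ⟩
        sumℚ (λ g → εℚ G P e * (δ e g * δ (π g) f))
          ≡⟨ *-distribˡ-sum (εℚ G P e) (λ g → δ e g * δ (π g) f) ⟨
        εℚ G P e * sumℚ (λ g → δ e g * δ (π g) f)
          ≡⟨ cong (εℚ G P e *_) (sum-δˡ e (λ g → δ (π g) f)) ⟩
        A e f
          ∎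

    ε≈±εℚ : ∀ e → ε G P e ≈± εℚ G P e
    ε≈±εℚ e with flipped e
    ... | false = plus
    ... | true  = minus

  module Similarity {G : Multigraph} (conn : Connected G) (P : Aut G) (root : Fin (Multigraph.n G))
                    {b} {B : Mat b (Multigraph.m G)} (basis : IsCycleBasis G B)
                    {M : Mat b b} (M-matrix : IsMatrixOf G P B M) where
    open Multigraph G
    open IsCycleBasis basis

    pathChain : ∀ {v} → Reach G root v → Fin m → ℚ
    pathChain here        f = 0ℚ
    pathChain (fwd e r _) f = pathChain r f + δ e f
    pathChain (bwd e r _) f = pathChain r f - δ e f

    ∂-pathChain : ∀ {v} (r : Reach G root v) w → (pathChain r · ∂ G) w ≡ δ v w - δ root w
    ∂-pathChain here w = trans (·-zeroˡ (∂ G) (λ _ → refl) w) (sym (ℚP.+-inverseʳ (δ root w)))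
    ∂-pathChain (fwd e r refl) w = begin
      ((λ f → pathChain r f + δ e f) · ∂ G) w
        ≡⟨ ·-distribʳ-+ (pathChain r) (δ e) (∂ G) w ⟩
      (pathChain r · ∂ G) w + (δ e · ∂ G) w
        ≡⟨ cong₂ _+_ (∂-pathChain r w) (δ-· e (∂ G) w) ⟩
      (δ (tail e) w - δ root w) + (δ (head e) w - δ (tail e) w)
        ≡⟨ solve 3 (λ t r h → (t :- r) :+ (h :- t) := h :- r) refl (δ (tail e) w) (δ root w) (δ (head e) w) ⟩
      δ (head e) w - δ root w
        ∎
      where open ≡-Reasoning
    ∂-pathChain (bwd e r refl) w = begin
      ((λ f → pathChain r f - δ e f) · ∂ G) w
        ≡⟨ ·-distribʳ-− (pathChain r) (δ e) (∂ G) w ⟩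
      (pathChain r · ∂ G) w - (δ e · ∂ G) w
        ≡⟨ cong₂ _-_ (∂-pathChain r w) (δ-· e (∂ G) w) ⟩
      (δ (head e) w - δ root w) - (δ (head e) w - δ (tail e) w)
        ≡⟨ solve 3 (λ h r t → (h :- r) :- (h :- t) := t :- r) refl (δ (head e) w) (δ root w) (δ (tail e) w) ⟩
      δ (tail e) w - δ root w
        ∎
      where open ≡-Reasoning

    -- Subtracting the chain of the chosen walk from root to root makes path root vanish exactly.
    path : Mat n m
    path v f = pathChain (conn root v) f - pathChain (conn root root) f

    ∂-path : ∀ v w → (path v · ∂ G) w ≡ δ v w - δ root w
    ∂-path v w = begin
      (path v · ∂ G) w
        ≡⟨ ·-distribʳ-− (pathChain (conn root v)) (pathChain (conn root root)) (∂ G) w ⟩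
      (pathChain (conn root v) · ∂ G) w - (pathChain (conn root root) · ∂ G) w
        ≡⟨ cong₂ _-_ (∂-pathChain (conn root v) w) (∂-pathChain (conn root root) w) ⟩
      (δ v w - δ root w) - (δ root w - δ root w)
        ≡⟨ solve 2 (λ x r → (x :- r) :- (r :- r) := x :- r) refl (δ v w) (δ root w) ⟩
      δ v w - δ root w
        ∎
      where open ≡-Reasoning

    path-root : ∀ f → path root f ≡ 0ℚ
    path-root f = ℚP.+-inverseʳ (pathChain (conn root root) f)


    cycle : ∀ z → (∀ v → (z · ∂ G) v ≡ 0ℚ) → IsCycle G z
    cycle z ∂z≡0 v = trans (boundary≡·∂ G z v) (∂z≡0 v)

    coords : ∀ z → (∀ v → (z · ∂ G) v ≡ 0ℚ) → Fin b → ℚ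
    coords z ∂z≡0 = proj₁ (span z (cycle z ∂z≡0))

    coords-spec : ∀ z (∂z≡0 : ∀ v → (z · ∂ G) v ≡ 0ℚ) e → z e ≡ (coords z ∂z≡0 · B) e
    coords-spec z ∂z≡0 = proj₂ (span z (cycle z ∂z≡0))

    coords-unique : ∀ (c c′ : Fin b → ℚ) → (∀ e → (c · B) e ≡ (c′ · B) e) → ∀ i → c i ≡ c′ i
    coords-unique c c′ same i = begin
      c i                    ≡⟨ solve 2 (λ x y → x := (x :- y) :+ y) refl (c i) (c′ i) ⟩
      (c i - c′ i) + c′ i    ≡⟨ cong (_+ c′ i) (indep (λ j → c j - c′ j) difference≡0 i) ⟩
      0ℚ + c′ i              ≡⟨ ℚP.+-identityˡ (c′ i) ⟩
      c′ i                   ∎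
      where
      open ≡-Reasoning
      difference≡0 : ∀ e → ((λ j → c j - c′ j) · B) e ≡ 0ℚ
      difference≡0 e =
        trans (·-distribʳ-− c c′ B e) (trans (cong (_- (c′ · B) e) (same e)) (ℚP.+-inverseʳ ((c′ · B) e)))

    ∂-B : ∀ i v → (B i · ∂ G) v ≡ 0ℚ
    ∂-B i v = trans (sym (boundary≡·∂ G (B i) v)) (cycles i v)

    ·path·∂ : ∀ (y : Fin n → ℚ) w → (y · path · ∂ G) w ≡ y w - sumℚ y * δ root w
    ·path·∂ y w = begin
      (y · path · ∂ G) w
        ≡⟨ ·-assoc y path (∂ G) w ⟩
      (y · (path ⊗ ∂ G)) w
        ≡⟨ ·-congʳ y (path ⊗ ∂ G) (λ v u → δ v u - δ root u) w (λ v → ∂-path v w) ⟩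
      (y · (λ v u → δ v u - δ root u)) w
        ≡⟨ ·-distribˡ-− y δ (λ _ u → δ root u) w ⟩
      (y · δ) w - sumℚ (λ v → y v * δ root w)
        ≡⟨ cong₂ _-_ (·-δ y w) (sym (*-distribʳ-sum (δ root w) y)) ⟩
      y w - sumℚ y * δ root w
        ∎
      where open ≡-Reasoning

    -- ζ = 1 − path ∘ ∂ projects C₁ onto the cycles; its coordinates κ are the C₁ → H₁ block of Ψ = Φ⁻¹.
    ζ : Mat m m
    ζ e f = δ e f - (∂ G e · path) f

    ∂-ζ : ∀ e w → (ζ e · ∂ G) w ≡ 0ℚ
    ∂-ζ e w = begin
      (ζ e · ∂ G) w
        ≡⟨ ·-distribʳ-− (δ e) (∂ G e · path) (∂ G) w ⟩
      (δ e · ∂ G) w - (∂ G e · path · ∂ G) w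
        ≡⟨ cong₂ _-_ (δ-· e (∂ G) w) (·path·∂ (∂ G e) w) ⟩
      ∂ G e w - (∂ G e w - sumℚ (∂ G e) * δ root w)
        ≡⟨ cong (λ s → ∂ G e w - (∂ G e w - s * δ root w)) (sum-∂ G e) ⟩
      ∂ G e w - (∂ G e w - 0ℚ * δ root w)
        ≡⟨ solve 2 (λ x r → x :- (x :- con 0ℚ :* r) := con 0ℚ) refl (∂ G e w) (δ root w) ⟩
      0ℚ
        ∎
      where open ≡-Reasoning

    ·ζ : ∀ z f → (z · ζ) f ≡ z f - (z · ∂ G · path) f
    ·ζ z f = begin
      (z · ζ) f                                       ≡⟨ ·-distribˡ-− z δ (∂ G ⊗ path) f ⟩
      (z · δ) f - (z · (∂ G ⊗ path)) f                ≡⟨ cong₂ _-_ (·-δ z f) (sym (·-assoc z (∂ G) path f)) ⟩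
      z f - (z · ∂ G · path) f                        ∎
      where open ≡-Reasoning

    κ : Mat m b
    κ e = coords (ζ e) (∂-ζ e)

    ·κ·B : ∀ z f → (z · κ · B) f ≡ (z · ζ) f
    ·κ·B z f = trans (·-assoc z κ B f) (·-congʳ z (κ ⊗ B) ζ f λ e → sym (coords-spec (ζ e) (∂-ζ e) f))

    ∂-P-path : ∀ v w → (path v · A P · ∂ G) w ≡ δ (σ P v) w - δ (σ P root) w
    ∂-P-path v w = begin
      (path v · A P · ∂ G) w
        ≡⟨ ·-assoc (path v) (A P) (∂ G) w ⟩
      (path v · (A P ⊗ ∂ G)) w
        ≡⟨ ·-congʳ (path v) (A P ⊗ ∂ G) (∂ G ⊗ (δ ∘ σ P)) w (λ e → ∂-equivariant P e w) ⟩
      (path v · (∂ G ⊗ (δ ∘ σ P))) w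
        ≡⟨ ·-assoc (path v) (∂ G) (δ ∘ σ P) w ⟨
      (path v · ∂ G · (δ ∘ σ P)) w
        ≡⟨ ·-congˡ (δ ∘ σ P) (∂-path v) w ⟩
      ((λ u → δ v u - δ root u) · (δ ∘ σ P)) w
        ≡⟨ ·-distribʳ-− (δ v) (δ root) (δ ∘ σ P) w ⟩
      (δ v · (δ ∘ σ P)) w - (δ root · (δ ∘ σ P)) w
        ≡⟨ cong₂ _-_ (δ-· v (δ ∘ σ P) w) (δ-· root (δ ∘ σ P) w) ⟩
      δ (σ P v) w - δ (σ P root) w
        ∎
      where open ≡-Reasoning

    -- η v measures how far P (path v) is from path (σ v); its coordinates K are the C₀ → H₁ block of N.
    η : Mat n m
    η v f = (path v · A P) f + path (σ P root) f - path (σ P v) f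

    ∂-η : ∀ v w → (η v · ∂ G) w ≡ 0ℚ
    ∂-η v w = begin
      (η v · ∂ G) w
        ≡⟨ ·-distribʳ-− (λ f → (path v · A P) f + path (σ P root) f) (path (σ P v)) (∂ G) w ⟩
      ((λ f → (path v · A P) f + path (σ P root) f) · ∂ G) w - (path (σ P v) · ∂ G) w
        ≡⟨ cong (_- (path (σ P v) · ∂ G) w) (·-distribʳ-+ (path v · A P) (path (σ P root)) (∂ G) w) ⟩
      (path v · A P · ∂ G) w + (path (σ P root) · ∂ G) w - (path (σ P v) · ∂ G) w
        ≡⟨ cong₂ (λ x y → x + y - (path (σ P v) · ∂ G) w) (∂-P-path v w) (∂-path (σ P root) w) ⟩
      (δ (σ P v) w - δ (σ P root) w) + (δ (σ P root) w - δ root w) - (path (σ P v) · ∂ G) w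
        ≡⟨ cong (λ x → (δ (σ P v) w - δ (σ P root) w) + (δ (σ P root) w - δ root w) - x) (∂-path (σ P v) w) ⟩
      (δ (σ P v) w - δ (σ P root) w) + (δ (σ P root) w - δ root w) - (δ (σ P v) w - δ root w)
        ≡⟨ solve 3 (λ x y r → (x :- y) :+ (y :- r) :- (x :- r) := con 0ℚ) refl
                   (δ (σ P v) w) (δ (σ P root) w) (δ root w) ⟩
      0ℚ
        ∎
      where open ≡-Reasoning

    K : Mat n b
    K v = coords (η v) (∂-η v)

    Φ : Mat (b ℕ.+ n) (m ℕ.+ 1)
    Φ = blocks B 𝟎 path 𝟏

    rootRow : Mat 1 n
    rootRow _ = δ root

    σrootRow : Mat 1 m
    σrootRow _ = path (σ P root)

    Ψ : Mat (m ℕ.+ 1) (b ℕ.+ n)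
    Ψ = blocks κ (∂ G) 𝟎 rootRow

    T : Mat (m ℕ.+ 1) (m ℕ.+ 1)
    T = blocks (A P) 𝟎 σrootRow 𝟏

    N : Mat (b ℕ.+ n) (b ℕ.+ n)
    N = blocks M 𝟎 K (δ ∘ σ P)

    -- Sizes of 𝟎 and 𝟏 are written out where unification would otherwise have to look inside ℚ arithmetic.
    Φ⊗Ψ≗δ : ∀ x y → (Φ ⊗ Ψ) x y ≡ δ x y
    Φ⊗Ψ≗δ = ⊗-blocks≗δ B 𝟎 path 𝟏 κ (∂ G) 𝟎 rootRow ≗₁₁ ≗₁₂ ≗₂₁ ≗₂₂
      where
      open ≡-Reasoning
      ≗₁₁ : ∀ i j → (B ⊗ κ) i j + (𝟎 {b} {1} ⊗ 𝟎) i j ≡ δ i j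
      ≗₁₁ i j = trans (cong ((B ⊗ κ) i j +_) (𝟎⊗ (𝟎 {1}) i j)) (trans (ℚP.+-identityʳ ((B ⊗ κ) i j))
        (coords-unique (B i · κ) (δ i) (λ f → begin
          (B i · κ · B) f                   ≡⟨ trans (·κ·B (B i) f) (·ζ (B i) f) ⟩
          B i f - (B i · ∂ G · path) f      ≡⟨ cong (λ x → B i f - x) (·-zeroˡ path (∂-B i) f) ⟩
          B i f - 0ℚ                        ≡⟨ ℚP.+-identityʳ (B i f) ⟩
          B i f                             ≡⟨ δ-· i B f ⟨
          (δ i · B) f                       ∎) j))
      ≗₁₂ : ∀ i w → (B ⊗ ∂ G) i w + (𝟎 ⊗ rootRow) i w ≡ 0ℚ
      ≗₁₂ i w = cong₂ _+_ (∂-B i w) (𝟎⊗ rootRow i w)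
      ≗₂₁ : ∀ v j → (path ⊗ κ) v j + (𝟏 {n} {1} ⊗ 𝟎) v j ≡ 0ℚ
      ≗₂₁ v j = cong₂ _+_ (indep (path v · κ) (λ f → begin
          (path v · κ · B) f
            ≡⟨ trans (·κ·B (path v) f) (·ζ (path v) f) ⟩
          path v f - (path v · ∂ G · path) f
            ≡⟨ cong (λ x → path v f - x) (·-congˡ path (∂-path v) f) ⟩
          path v f - ((λ u → δ v u - δ root u) · path) f
            ≡⟨ cong (λ x → path v f - x) (·-distribʳ-− (δ v) (δ root) path f) ⟩
          path v f - ((δ v · path) f - (δ root · path) f)
            ≡⟨ cong₂ (λ x y → path v f - (x - y)) (δ-· v path f) (trans (δ-· root path f) (path-root f)) ⟩
          path v f - (path v f - 0ℚ)
            ≡⟨ solve 1 (λ x → x :- (x :- con 0ℚ) := con 0ℚ) refl (path v f) ⟩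
          0ℚ
            ∎) j)
        (⊗𝟎 (𝟏 {n} {1}) v j)
      ≗₂₂ : ∀ v w → (path ⊗ ∂ G) v w + (𝟏 ⊗ rootRow) v w ≡ δ v w
      ≗₂₂ v w = trans (cong₂ _+_ (∂-path v w) (solve 1 (λ x → con 1ℚ :* x :+ con 0ℚ := x) refl (δ root w)))
                      (solve 2 (λ x r → x :- r :+ r := x) refl (δ v w) (δ root w))

    Ψ⊗Φ≗δ : ∀ x y → (Ψ ⊗ Φ) x y ≡ δ x y
    Ψ⊗Φ≗δ = ⊗-blocks≗δ κ (∂ G) 𝟎 rootRow B 𝟎 path 𝟏 ≗₁₁ ≗₁₂ ≗₂₁ ≗₂₂
      where
      ≗₁₁ : ∀ e f → (κ ⊗ B) e f + (∂ G ⊗ path) e f ≡ δ e f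
      ≗₁₁ e f = trans (cong (_+ (∂ G ⊗ path) e f) (sym (coords-spec (ζ e) (∂-ζ e) f)))
                      (solve 2 (λ x y → x :- y :+ y := x) refl (δ e f) ((∂ G ⊗ path) e f))
      ≗₁₂ : ∀ e t → (κ ⊗ 𝟎 {b} {1}) e t + (∂ G ⊗ 𝟏) e t ≡ 0ℚ
      ≗₁₂ e t = trans (cong₂ _+_ (⊗𝟎 κ e t) (trans (sum-cong λ v → ℚP.*-identityʳ (∂ G e v)) (sum-∂ G e)))
                      (ℚP.+-identityˡ 0ℚ)
      ≗₂₁ : ∀ t f → (𝟎 {1} ⊗ B) t f + (rootRow ⊗ path) t f ≡ 0ℚ
      ≗₂₁ t f = trans (cong₂ _+_ (𝟎⊗ B t f) (trans (δ-· root path f) (path-root f))) (ℚP.+-identityˡ 0ℚ)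
      ≗₂₂ : ∀ t t′ → (𝟎 {1} {b} ⊗ 𝟎) t t′ + (rootRow ⊗ 𝟏 {n} {1}) t t′ ≡ δ t t′
      ≗₂₂ zero zero = trans (cong₂ _+_ (𝟎⊗ {1} (𝟎 {b} {1}) zero zero)
                                       (trans (sum-cong λ v → ℚP.*-identityʳ (δ root v)) (sum-δ root)))
                            (ℚP.+-identityˡ 1ℚ)

    Φ⊗T≗N⊗Φ : ∀ x y → (Φ ⊗ T) x y ≡ (N ⊗ Φ) x y
    Φ⊗T≗N⊗Φ = ⊗-blocks-cong B 𝟎 path 𝟏 (A P) 𝟎 σrootRow 𝟏 M 𝟎 K (δ ∘ σ P) B 𝟎 path 𝟏
                            ≗₁₁ ≗₁₂ ≗₂₁ ≗₂₂
      where
      ≗₁₁ : ∀ i f → (B ⊗ A P) i f + (𝟎 ⊗ σrootRow) i f ≡ (M ⊗ B) i f + (𝟎 ⊗ path) i f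
      ≗₁₂ : ∀ i t → (B ⊗ 𝟎 {m} {1}) i t + (𝟎 {b} {1} ⊗ 𝟏) i t ≡ (M ⊗ 𝟎) i t + (𝟎 {b} {n} ⊗ 𝟏) i t
      ≗₂₁ : ∀ v f → (path ⊗ A P) v f + (𝟏 ⊗ σrootRow) v f ≡ (K ⊗ B) v f + ((δ ∘ σ P) ⊗ path) v f
      ≗₂₂ : ∀ v t → (path ⊗ 𝟎 {m} {1}) v t + (𝟏 {n} {1} ⊗ 𝟏) v t ≡ (K ⊗ 𝟎) v t + ((δ ∘ σ P) ⊗ 𝟏) v t
      ≗₁₁ i f = cong₂ _+_ (trans (sym (PE-chain≡·A P (B i) f)) (M-matrix i f))
                          (trans (𝟎⊗ σrootRow i f) (sym (𝟎⊗ path i f)))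
      ≗₁₂ i t = cong₂ _+_ (trans (⊗𝟎 B i t) (sym (⊗𝟎 M i t)))
                          (trans (𝟎⊗ (𝟏 {1}) i t) (sym (𝟎⊗ (𝟏 {n}) i t)))
      ≗₂₁ v f = sym (begin
        (K ⊗ B) v f + ((δ ∘ σ P) ⊗ path) v f
          ≡⟨ cong₂ _+_ (sym (coords-spec (η v) (∂-η v) f)) (δ-· (σ P v) path f) ⟩
        (path v · A P) f + path (σ P root) f - path (σ P v) f + path (σ P v) f
          ≡⟨ solve 3 (λ a r s → a :+ r :- s :+ s := a :+ (con 1ℚ :* r :+ con 0ℚ)) refl
                   ((path v · A P) f) (path (σ P root) f) (path (σ P v) f) ⟩
        (path ⊗ A P) v f + (𝟏 ⊗ σrootRow) v f
          ∎)
        where open ≡-Reasoning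
      ≗₂₂ v zero = cong₂ _+_ (trans (⊗𝟎 {r = 1} path v zero) (sym (⊗𝟎 {r = 1} K v zero)))
                             (sym (trans (sum-cong λ w → ℚP.*-identityʳ (δ (σ P v) w)) (sum-δ (σ P v))))

    det-M*det-σ≡det-A : det M * det (δ ∘ σ P) ≡ det (A P)
    det-M*det-σ≡det-A = begin
      det M * det (δ ∘ σ P)           ≡⟨ det-blocks M K (δ ∘ σ P) ⟨
      det N                           ≡⟨ det-similar Φ Ψ N T Φ⊗Ψ≗δ Ψ⊗Φ≗δ Φ⊗T≗N⊗Φ ⟩
      det T                           ≡⟨ det-blocks (A P) σrootRow 𝟏 ⟩
      det (A P) * 1ℚ                  ≡⟨ ℚP.*-identityʳ (det (A P)) ⟩
      det (A P)                       ∎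
      where open ≡-Reasoning

    det-M : det M ≡ prodℚ (εℚ G P) * -1^ inversions (π P) * -1^ inversions (σ P)
    det-M = begin
      det M
        ≡⟨ ℚP.*-identityʳ (det M) ⟨
      det M * 1ℚ
        ≡⟨ cong (det M *_) (-1^-square (inversions (σ P))) ⟨
      det M * (s * s)
        ≡⟨ ℚP.*-assoc (det M) s s ⟨
      det M * s * s
        ≡⟨ cong (λ x → det M * x * s) (det-permutation (σ P) (σ-injective P)) ⟨
      det M * det (δ ∘ σ P) * s
        ≡⟨ cong (_* s) (trans det-M*det-σ≡det-A (det-A P)) ⟩
      prodℚ (εℚ G P) * -1^ inversions (π P) * s
        ∎
      where
      open ≡-Reasoning
      s : ℚ
      s = -1^ inversions (σ P)

    sign-det-M : signℚ (det M) ≡ prodℤ (ε G P) ℤ.* negOnePow (inversions (π P)) ℤ.* negOnePow (inversions (σ P))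
    sign-det-M = trans (cong signℚ det-M) (signℚ-≈± (≈±-* (≈±-* (prod≈± (ε G P) (εℚ G P) (ε≈±εℚ P))
                                                                (negOnePow≈±-1^ (inversions (π P))))
                                                          (negOnePow≈±-1^ (inversions (σ P)))))

    ΘK≡ΘS : signFun (π P) ℤ.* signℚ (det M) ≡ ΘS G P
    ΘK≡ΘS = begin
      x ℤ.* signℚ (det M)        ≡⟨ cong (x ℤ.*_) sign-det-M ⟩
      x ℤ.* (e ℤ.* x ℤ.* y)      ≡⟨ cong (λ t → x ℤ.* (t ℤ.* y)) (ℤP.*-comm e x) ⟩
      x ℤ.* (x ℤ.* e ℤ.* y)      ≡⟨ cong (x ℤ.*_) (ℤP.*-assoc x e y) ⟩
      x ℤ.* (x ℤ.* (e ℤ.* y))    ≡⟨ ℤP.*-assoc x x (e ℤ.* y) ⟨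
      x ℤ.* x ℤ.* (e ℤ.* y)      ≡⟨ cong (ℤ._* (e ℤ.* y)) (≈±-square (negOnePow≈±-1^ (inversions (π P)))) ⟩
      ℤ.1ℤ ℤ.* (e ℤ.* y)         ≡⟨ ℤP.*-identityˡ (e ℤ.* y) ⟩
      e ℤ.* y                    ≡⟨ ℤP.*-comm e y ⟩
      y ℤ.* e                    ∎
      where
      open ≡-Reasoning
      x y e : ℤ
      x = negOnePow (inversions (π P))
      y = negOnePow (inversions (σ P))
      e = prodℤ (ε G P)

open import Defs
open import Data.Nat using (ℕ; zero; suc)
open import Data.Fin using (Fin; zero)
open import Data.Bool using (false)
open import Data.Product using (_,_)
open import Data.Integer using (_*_)
open import Data.Rational using (ℚ; 1ℚ)
open import Relation.Binary.PropositionalEquality using (_≡_; refl)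
open GraphHomology using (module Similarity)

mainTheorem1 : (G : Multigraph) → Connected G → (P : Aut G) →
    (b : ℕ) (B : Fin b → Fin (Multigraph.m G) → ℚ) → IsCycleBasis G B →
    (M : Fin b → Fin b → ℚ) → IsMatrixOf G P B M →
    signFun (PEfun G P) * signℚ (det M) ≡ ΘS G P
mainTheorem1 G@record { n = suc _ } conn P b B basis M M-matrix = Similarity.ΘK≡ΘS conn P zero basis M-matrix
mainTheorem1 record { n = zero ; m = suc _ ; attach = attach } _ _ _ _ _ _ _ with attach (zero , false)
... | ()
mainTheorem1 record { n = zero ; m = zero } _ _ zero    _ _     _ _ = refl
mainTheorem1 record { n = zero ; m = zero } _ _ (suc b) _ basis _ _
  with IsCycleBasis.indep basis (λ _ → 1ℚ) (λ ()) zero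
... | ()
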